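{- Let $r\in\mathbb N$, let $L_r$ be a nonempty subset of $\{2,4,\dots,2r\}$, and let $n\in\mathbb N_0$. Let $\mathcal P_e(n,L_r,2r)$ (resp. $\mathcal P_o(n,L_r,2r)$) be the set of partitions of $n$ in which odd parts are unrestricted, every even part is congruent modulo $2r$ to some element of $L_r$, and the number of even parts (with multiplicity) is even (resp. odd). For $m\in\mathbb N_0$ let $\mathcal Q(m,L_r,r)$ be the set of partitions of $m$ into distinct parts in which no even part is congruent modulo $2r$ to an element of $L_r$. Then \[ \sum_{\lambda\in\mathcal P_e(n,L_r,2r)}\ell(\lambda)-\sum_{\lambda\in\mathcal P_o(n,L_r,2r)}\ell(\lambda)-\sum_{\lambda\in\mathcal Q(n,L_r,r)}\ell(\lambda) \] equals the number of pairs $(\lambda,(a^b))$ with $a,b$ positive integers such that (i) $a$ is even, and (ii) $\lambda\in\mathcal Q(n-ab,L_r,r)$.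
   Context: A partition is a non-increasing sequence of positive integers; the empty partition is allowed for $\lambda$. $(a^b)$ denotes the partition with $b$ parts equal to $a$. $\ell(\lambda)$ is the number of parts of $\lambda$ counted with multiplicity. -}

module Defs where

open import Data.Nat using (ℕ; zero; suc; _+_; _*_; _∸_; _≤_; _≥_; _>_; ∣_-_∣)
open import Data.Nat.Properties using (_≤?_; _≟_)
open import Data.Nat.Divisibility using (_∣_; _∣?_)
open import Data.Integer using (ℤ) renaming (_+_ to _+ℤ_; _-_ to _-ℤ_)
import Data.Integer as ℤ
open import Data.List using (List; []; _∷_; map; concatMap; filter; length; upTo)
open import Data.Nat.ListAction using (sum)
open import Data.List.Relation.Unary.All using (All; all?)
open import Data.List.Relation.Unary.Any using (Any; any?)
open import Data.List.Relation.Unary.Linked using (Linked; linked?)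
open import Data.Product using (_×_)
open import Relation.Nullary using (Dec; ¬_)
open import Relation.Nullary.Decidable using (_×-dec_; ¬?; _→-dec_)
open import Relation.Binary.PropositionalEquality using (_≡_)

Even : ℕ → Set
Even x = 2 ∣ x

even? : (x : ℕ) → Dec (Even x)
even? x = 2 ∣? x

Cong : ℕ → ℕ → ℕ → Set
Cong m x y = m ∣ ∣ x - y ∣

cong? : (m x y : ℕ) → Dec (Cong m x y)
cong? m x y = m ∣? ∣ x - y ∣

CongL : ℕ → List ℕ → ℕ → Set
CongL r L x = Any (Cong (2 * r) x) L

congL? : (r : ℕ) (L : List ℕ) (x : ℕ) → Dec (CongL r L x)
congL? r L x = any? (cong? (2 * r) x) L

IsPartition : ℕ → List ℕ → Set
IsPartition n λ′ = Linked _≥_ λ′ × All (1 ≤_) λ′ × sum λ′ ≡ n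

isPartition? : (n : ℕ) (λ′ : List ℕ) → Dec (IsPartition n λ′)
isPartition? n λ′ = linked? (λ x y → y ≤? x) λ′ ×-dec (all? (1 ≤?_) λ′ ×-dec (sum λ′ ≟ n))

IsDistinctPartition : ℕ → List ℕ → Set
IsDistinctPartition n λ′ = Linked _>_ λ′ × All (1 ≤_) λ′ × sum λ′ ≡ n

isDistinctPartition? : (n : ℕ) (λ′ : List ℕ) → Dec (IsDistinctPartition n λ′)
isDistinctPartition? n λ′ = linked? (λ x y → suc y ≤? x) λ′ ×-dec (all? (1 ≤?_) λ′ ×-dec (sum λ′ ≟ n))

numEven : List ℕ → ℕ
numEven λ′ = length (filter even? λ′)

InP : ℕ → List ℕ → ℕ → List ℕ → Set
InP r L n λ′ = IsPartition n λ′ × All (λ x → Even x → CongL r L x) λ′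

inP? : ∀ r L n λ′ → Dec (InP r L n λ′)
inP? r L n λ′ = isPartition? n λ′ ×-dec all? (λ x → even? x →-dec congL? r L x) λ′

InPe : ℕ → List ℕ → ℕ → List ℕ → Set
InPe r L n λ′ = InP r L n λ′ × Even (numEven λ′)

inPe? : ∀ r L n λ′ → Dec (InPe r L n λ′)
inPe? r L n λ′ = inP? r L n λ′ ×-dec even? (numEven λ′)

InPo : ℕ → List ℕ → ℕ → List ℕ → Set
InPo r L n λ′ = InP r L n λ′ × ¬ Even (numEven λ′)

inPo? : ∀ r L n λ′ → Dec (InPo r L n λ′)
inPo? r L n λ′ = inP? r L n λ′ ×-dec ¬? (even? (numEven λ′))

InQ : ℕ → List ℕ → ℕ → List ℕ → Set
InQ r L m λ′ = IsDistinctPartition m λ′ × All (λ x → ¬ (Even x × CongL r L x)) λ′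

inQ? : ∀ r L m λ′ → Dec (InQ r L m λ′)
inQ? r L m λ′ = isDistinctPartition? m λ′ ×-dec all? (λ x → ¬? (even? x ×-dec congL? r L x)) λ′

oneTo : ℕ → List ℕ
oneTo m = map suc (upTo m)

listsOfLength : ℕ → ℕ → List (List ℕ)
listsOfLength zero    m = [] ∷ []
listsOfLength (suc k) m = concatMap (λ x → map (x ∷_) (listsOfLength k m)) (oneTo m)

-- all lists of length ≤ n with entries in [1 .. n]; every partition of n is among them
candidates : ℕ → List (List ℕ)
candidates n = concatMap (λ k → listsOfLength k n) (upTo (suc n))

-- the finite sets of partitions, as lists (each partition listed exactly once)
Pe Po Q : ℕ → List ℕ → ℕ → List (List ℕ)
Pe r L n = filter (inPe? r L n) (candidates n)
Po r L n = filter (inPo? r L n) (candidates n)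
Q  r L m = filter (inQ? r L m) (candidates m)

sumLengths : List (List ℕ) → ℕ
sumLengths S = sum (map length S)

evenABPairs : ℕ → List (ℕ × ℕ)
evenABPairs n = filter (λ p → even? (proj₁ p) ×-dec (proj₁ p * proj₂ p ≤? n))
                  (concatMap (λ a → map (a ,_) (oneTo n)) (oneTo n))
  where open import Data.Product using (proj₁; proj₂; _,_)

pairCount : ℕ → List ℕ → ℕ → ℕ
pairCount r L n = sum (map (λ p → length (Q r L (n ∸ proj₁ p * proj₂ p))) (evenABPairs n))
  where open import Data.Product using (proj₁; proj₂)

SubsetEvenUpTo : ℕ → List ℕ → Set
SubsetEvenUpTo r L = All (λ l → Even l × 2 ≤ l × l ≤ 2 * r) L

-- Give every part the weight z.  Writing S for the even numbers congruent modulo 2r to an element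
-- of L, the signed series of P is ∏_{k odd} (1 − z qᵏ)⁻¹ ∏_{k ∈ S} (1 + z qᵏ)⁻¹ and the series of Q is
-- ∏_{k odd} (1 + z qᵏ) ∏_{k even, k ∉ S} (1 + z qᵏ).  At z = 1 they coincide by Euler's identity
-- ∏_{k odd} (1 − qᵏ)⁻¹ = ∏_k (1 + qᵏ), and comparing logarithmic derivatives at z = 1 gives
-- P′ − Q′ = Q · ∑_{a even} qᵃ / (1 − qᵃ), whose coefficient of qⁿ counts the pairs (λ, (aᵇ)).
-- Both facts are obtained at once by evaluating at z = 1 + ε over the dual numbers ℤ[ε]: the
-- ε-part of a coefficient is a sum of lengths.  All series identities are proved up to degree n,
-- where the infinite products become finite ones.

module Submission where

open import Defs
open import Data.Nat using (ℕ; _≤_)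
open import Data.List using (List; _∷_)
open import Relation.Binary.PropositionalEquality using (_≡_)
open import Algebra.Core using (Op₁; Op₂)
open import Algebra.Structures using (IsCommutativeRing)

module Parity where

  open import Data.Nat using (zero; suc; _+_)
  open import Data.Nat.Properties using (+-comm; *-identityʳ; *-suc)
  open import Data.Nat.Divisibility using (divides; _∣0; ∣-refl; ∣m∣n⇒∣m+n; ∣m+n∣m⇒∣n; ∣1⇒≡1)
  open import Data.Sum using (_⊎_; inj₁; inj₂)
  open import Relation.Nullary using (¬_)
  open import Relation.Binary.PropositionalEquality using (sym; trans; cong; subst)

  even-or-next-even : ∀ k → Even k ⊎ Even (suc k)
  even-or-next-even zero    = inj₁ (2 ∣0)
  even-or-next-even (suc k) with even-or-next-even k
  ... | inj₁ even-k   = inj₂ (∣m∣n⇒∣m+n {2} {2} {k} ∣-refl even-k)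
  ... | inj₂ even-1+k = inj₁ even-1+k

  not-even-and-next-even : ∀ k → Even k → ¬ Even (suc k)
  not-even-and-next-even k even-k even-1+k
    with ∣1⇒≡1 (∣m+n∣m⇒∣n {2} {k} {1} (subst Even (+-comm 1 k) even-1+k) even-k)
  ... | ()

  even-double : ∀ t → Even (t + t)
  even-double t = divides t (trans (cong (_+_ t) (sym (*-identityʳ t))) (sym (*-suc t 1)))

  odd-double : ∀ t → ¬ Even (suc (t + t))
  odd-double t = not-even-and-next-even (t + t) (even-double t)

module PowerSeries {A : Set} {add mul : Op₂ A} {neg : Op₁ A} {0ᴬ 1ᴬ : A}
                   (isCommutativeRing : IsCommutativeRing _≡_ add mul neg 0ᴬ 1ᴬ) where

  open import Relation.Binary.PropositionalEquality
    using (refl; sym; trans; cong; cong₂; subst; _≢_; _≗_; module ≡-Reasoning)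
  open import Level using (0ℓ)
  open import Algebra.Bundles using (CommutativeRing)
  open import Data.Maybe using (nothing)
  open import Tactic.RingSolver.Core.AlmostCommutativeRing using (fromCommutativeRing)
  open import Data.Nat as ℕ using (ℕ; zero; suc; _∸_; _≤_; _<_; z≤n; s≤s; _≟_; _≤?_)
  open import Data.Nat.Properties
    using (suc-injective; n≤1+n; 1+n≰n; ≤-refl; ≤-trans; ≤-pred; <⇒≤; ≤-<-trans; <-≤-trans; <-irrefl;
           m≤n⇒m≤1+n; ≤∧≢⇒<; m∸n≤m; n∸n≡0; m∸[m∸n]≡n; m+[n∸m]≡n; m+n∸m≡n; m+n∸n≡m; +-∸-assoc;
           ∸-+-assoc; m≤m+n; m≤n⇒m<n∨m≡n; n≤0⇒n≡0)
  import Data.Nat.Properties as ℕₚ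
  open import Data.Empty using (⊥-elim)
  open import Function using (_∘_; id)
  open import Data.List using (List; []; _∷_; _++_; map; concatMap; applyUpTo; upTo)
  open import Defs using (oneTo; listsOfLength; candidates; Even; even?)
  open Parity
  open import Data.Nat.ListAction using (sum)
  open import Data.List.Relation.Unary.All using (All; all?; []; _∷_)
  open import Data.List.Relation.Unary.Linked as Linked using (Linked; linked?; []; [-]; _∷_)
  open import Relation.Nullary using (Dec; yes; no; ¬_)
  open import Relation.Nullary.Decidable using (_×-dec_)
  open import Data.Product using (_×_; _,_; proj₁; proj₂)
  import Data.Sum
  open Data.Sum using (_⊎_; inj₁; inj₂; [_,_])

  coefficientRing : CommutativeRing 0ℓ 0ℓ
  coefficientRing = record { isCommutativeRing = isCommutativeRing }

  open CommutativeRing coefficientRing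
    using (_+_; _*_; -_; 0#; 1#; -‿inverseˡ; -‿inverseʳ; +-assoc; +-comm; +-identityˡ; +-identityʳ;
           *-assoc; *-comm; *-identityˡ; *-identityʳ;
           distribˡ; distribʳ; zeroˡ; zeroʳ; +-commutativeSemigroup)
  open import Algebra.Properties.CommutativeSemigroup +-commutativeSemigroup using (interchange)
  open import Algebra.Properties.Ring (CommutativeRing.ring coefficientRing)
    using (+-cancelˡ; -‿distribˡ-*; -‿distribʳ-*; -0#≈0#; -‿+-comm)

  infixr 8 [_]∙_
  [_]∙_ : {P : Set} → Dec P → A → A
  [ yes _ ]∙ a = a
  [ no  _ ]∙ a = 0#

  ∑ : ℕ → (ℕ → A) → A
  ∑ zero    f = 0#
  ∑ (suc n) f = ∑ n f + f n

  ∑-cong : ∀ n {f g : ℕ → A} → (∀ i → i < n → f i ≡ g i) → ∑ n f ≡ ∑ n g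
  ∑-cong zero    eq = refl
  ∑-cong (suc n) eq = cong₂ _+_ (∑-cong n (λ i i<n → eq i (m≤n⇒m≤1+n i<n))) (eq n ≤-refl)

  ∑-zero : ∀ n {f : ℕ → A} → (∀ i → i < n → f i ≡ 0#) → ∑ n f ≡ 0#
  ∑-zero zero    eq = refl
  ∑-zero (suc n) eq =
    trans (cong₂ _+_ (∑-zero n (λ i i<n → eq i (m≤n⇒m≤1+n i<n))) (eq n ≤-refl)) (+-identityʳ 0#)

  ∑-+ : ∀ n (f g : ℕ → A) → ∑ n (λ i → f i + g i) ≡ ∑ n f + ∑ n g
  ∑-+ zero    f g = sym (+-identityʳ 0#)
  ∑-+ (suc n) f g =
    trans (cong (_+ (f n + g n)) (∑-+ n f g)) (interchange (∑ n f) (∑ n g) (f n) (g n))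

  ∑-*ˡ : ∀ n c (f : ℕ → A) → c * ∑ n f ≡ ∑ n (λ i → c * f i)
  ∑-*ˡ zero    c f = zeroʳ c
  ∑-*ˡ (suc n) c f = trans (distribˡ c (∑ n f) (f n)) (cong (_+ c * f n) (∑-*ˡ n c f))

  ∑-head : ∀ n (f : ℕ → A) → ∑ (suc n) f ≡ f 0 + ∑ n (f ∘ suc)
  ∑-head zero    f = trans (+-identityˡ (f 0)) (sym (+-identityʳ (f 0)))
  ∑-head (suc n) f = trans (cong (_+ f (suc n)) (∑-head n f)) (+-assoc (f 0) _ _)

  ∑-single : ∀ n k {f : ℕ → A} → k < n → (∀ i → i < n → i ≢ k → f i ≡ 0#) → ∑ n f ≡ f k
  ∑-single (suc n) k {f} k<1+n off with k ≟ n
  ... | yes refl = trans (cong (_+ f k) (∑-zero n (λ i i<n → off i (m≤n⇒m≤1+n i<n) (λ { refl → <-irrefl refl i<n }))))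
                         (+-identityˡ (f k))
  ... | no  k≢n  = trans (cong₂ _+_ (∑-single n k (≤∧≢⇒< (≤-pred k<1+n) k≢n) (λ i i<n → off i (m≤n⇒m≤1+n i<n)))
                                    (off n ≤-refl (k≢n ∘ sym)))
                         (+-identityʳ (f k))

  ∑-reverse : ∀ n (f : ℕ → A) → ∑ (suc n) f ≡ ∑ (suc n) (λ i → f (n ∸ i))
  ∑-reverse zero    f = refl
  ∑-reverse (suc n) f = begin
    ∑ (suc n) f + f (suc n)                     ≡⟨ cong (_+ f (suc n)) (∑-reverse n f) ⟩
    ∑ (suc n) (λ i → f (n ∸ i)) + f (suc n)     ≡⟨ +-comm _ (f (suc n)) ⟩
    f (suc n) + ∑ (suc n) (λ i → f (n ∸ i))     ≡⟨ ∑-head (suc n) (λ i → f (suc n ∸ i)) ⟨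
    ∑ (suc (suc n)) (λ i → f (suc n ∸ i))       ∎
    where open ≡-Reasoning

  ∑-swap : ∀ m n (a : ℕ → ℕ → A) → ∑ m (λ i → ∑ n (a i)) ≡ ∑ n (λ j → ∑ m (λ i → a i j))
  ∑-swap zero    n a = sym (∑-zero n (λ _ _ → refl))
  ∑-swap (suc m) n a = trans (cong (_+ ∑ n (a m)) (∑-swap m n a)) (sym (∑-+ n _ (a m)))

  ∑-triangle : ∀ n (a : ℕ → ℕ → A) →
    ∑ n (λ i → ∑ (suc i) (a i)) ≡ ∑ n (λ j → ∑ (n ∸ j) (λ k → a (j ℕ.+ k) j))
  ∑-triangle zero    a = refl
  ∑-triangle (suc n) a = begin
    ∑ n (λ i → ∑ (suc i) (a i)) + (∑ n (a n) + a n n)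
      ≡⟨ cong (_+ (∑ n (a n) + a n n)) (∑-triangle n a) ⟩
    ∑ n (λ j → ∑ (n ∸ j) (λ k → a (j ℕ.+ k) j)) + (∑ n (a n) + a n n)
      ≡⟨ +-assoc _ (∑ n (a n)) (a n n) ⟨
    (∑ n (λ j → ∑ (n ∸ j) (λ k → a (j ℕ.+ k) j)) + ∑ n (a n)) + a n n
      ≡⟨ cong₂ _+_ (sym (∑-+ n _ (a n))) (sym (trans (+-identityˡ _) (cong (λ z → a z n) (ℕₚ.+-identityʳ n)))) ⟩
    ∑ n (λ j → ∑ (n ∸ j) (λ k → a (j ℕ.+ k) j) + a n j) + ∑ 1 (λ k → a (n ℕ.+ k) n)
      ≡⟨ cong₂ _+_ (∑-cong n extend) (cong (λ z → ∑ z (λ k → a (n ℕ.+ k) n)) (sym (m+n∸n≡m 1 n))) ⟩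
    ∑ n (λ j → ∑ (suc n ∸ j) (λ k → a (j ℕ.+ k) j)) + ∑ (suc n ∸ n) (λ k → a (n ℕ.+ k) n) ∎
    where
    open ≡-Reasoning
    extend : ∀ j → j < n → ∑ (n ∸ j) (λ k → a (j ℕ.+ k) j) + a n j ≡ ∑ (suc n ∸ j) (λ k → a (j ℕ.+ k) j)
    extend j j<n = begin
      ∑ (n ∸ j) (λ k → a (j ℕ.+ k) j) + a n j
        ≡⟨ cong (λ z → ∑ (n ∸ j) (λ k → a (j ℕ.+ k) j) + a z j) (sym (m+[n∸m]≡n (<⇒≤ j<n))) ⟩
      ∑ (suc (n ∸ j)) (λ k → a (j ℕ.+ k) j)
        ≡⟨ cong (λ z → ∑ z (λ k → a (j ℕ.+ k) j)) (sym (+-∸-assoc 1 (<⇒≤ j<n))) ⟩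
      ∑ (suc n ∸ j) (λ k → a (j ℕ.+ k) j) ∎

  []-yes : {P : Set} (p : Dec P) → P → ∀ a → [ p ]∙ a ≡ a
  []-yes (yes _) _  a = refl
  []-yes (no ¬p) pr a = ⊥-elim (¬p pr)

  []-no : {P : Set} (p : Dec P) → ¬ P → ∀ a → [ p ]∙ a ≡ 0#
  []-no (yes pr) ¬p a = ⊥-elim (¬p pr)
  []-no (no _)   _  a = refl

  []-⇔ : {P Q : Set} → (P → Q) → (Q → P) → (p : Dec P) (q : Dec Q) → ∀ a → [ p ]∙ a ≡ [ q ]∙ a
  []-⇔ to from (yes _)  (yes _)  a = refl
  []-⇔ to from (no _)   (no _)   a = refl
  []-⇔ to from (yes pr) (no ¬q)  a = ⊥-elim (¬q (to pr))
  []-⇔ to from (no ¬p)  (yes qr) a = ⊥-elim (¬p (from qr))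

  []-×-dec : {P Q : Set} (p : Dec P) (q : Dec Q) → ∀ a → [ p ]∙ [ q ]∙ a ≡ [ p ×-dec q ]∙ a
  []-×-dec (yes _) (yes _) a = refl
  []-×-dec (yes _) (no _)  a = refl
  []-×-dec (no _)  _       a = refl

  []-*-[] : {P Q : Set} (p : Dec P) (q : Dec Q) → ∀ a b → ([ p ]∙ a) * ([ q ]∙ b) ≡ [ q ]∙ [ p ]∙ (a * b)
  []-*-[] (yes _) (yes _) a b = refl
  []-*-[] (yes _) (no _)  a b = zeroʳ a
  []-*-[] (no _)  (yes _) a b = zeroˡ b
  []-*-[] (no _)  (no _)  a b = zeroˡ 0#

  []-0# : {P : Set} (p : Dec P) → [ p ]∙ 0# ≡ 0#
  []-0# (yes _) = refl
  []-0# (no _)  = refl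

  *-[] : {P : Set} (p : Dec P) → ∀ c a → c * ([ p ]∙ a) ≡ [ p ]∙ (c * a)
  *-[] (yes _) c a = refl
  *-[] (no _)  c a = zeroʳ c

  ∑-[] : {P : Set} (p : Dec P) → ∀ n (f : ℕ → A) → ∑ n (λ i → [ p ]∙ f i) ≡ [ p ]∙ ∑ n f
  ∑-[] (yes _) n f = refl
  ∑-[] (no _)  n f = ∑-zero n (λ _ _ → refl)

  ∑ₗ : {B : Set} → (B → A) → List B → A
  ∑ₗ f []       = 0#
  ∑ₗ f (x ∷ xs) = f x + ∑ₗ f xs

  module _ {B : Set} where

    ∑ₗ-cong : ∀ {f g : B → A} xs → (∀ x → f x ≡ g x) → ∑ₗ f xs ≡ ∑ₗ g xs
    ∑ₗ-cong []       eq = refl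
    ∑ₗ-cong (x ∷ xs) eq = cong₂ _+_ (eq x) (∑ₗ-cong xs eq)

    ∑ₗ-++ : ∀ (f : B → A) xs ys → ∑ₗ f (xs ++ ys) ≡ ∑ₗ f xs + ∑ₗ f ys
    ∑ₗ-++ f []       ys = sym (+-identityˡ (∑ₗ f ys))
    ∑ₗ-++ f (x ∷ xs) ys = trans (cong (f x +_) (∑ₗ-++ f xs ys)) (sym (+-assoc (f x) _ _))

    ∑ₗ-applyUpTo : ∀ (f : B → A) n (g : ℕ → B) → ∑ₗ f (applyUpTo g n) ≡ ∑ n (f ∘ g)
    ∑ₗ-applyUpTo f zero    g = refl
    ∑ₗ-applyUpTo f (suc n) g = trans (cong (f (g 0) +_) (∑ₗ-applyUpTo f n (g ∘ suc))) (sym (∑-head n (f ∘ g)))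

  module _ {B C : Set} where

    ∑ₗ-map : ∀ (f : C → A) (g : B → C) xs → ∑ₗ f (map g xs) ≡ ∑ₗ (f ∘ g) xs
    ∑ₗ-map f g []       = refl
    ∑ₗ-map f g (x ∷ xs) = cong (f (g x) +_) (∑ₗ-map f g xs)

    ∑ₗ-concatMap : ∀ (f : C → A) (g : B → List C) xs → ∑ₗ f (concatMap g xs) ≡ ∑ₗ (∑ₗ f ∘ g) xs
    ∑ₗ-concatMap f g []       = refl
    ∑ₗ-concatMap f g (x ∷ xs) = trans (∑ₗ-++ f (g x) (concatMap g xs)) (cong (∑ₗ f (g x) +_) (∑ₗ-concatMap f g xs))

  ∑ₗ-+- : ∀ {B : Set} (f g : B → A) xs → ∑ₗ (λ x → f x + - g x) xs ≡ ∑ₗ f xs + - ∑ₗ g xs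
  ∑ₗ-+- f g []       = sym (-‿inverseʳ 0#)
  ∑ₗ-+- f g (x ∷ xs) = begin
    (f x + - g x) + ∑ₗ (λ x → f x + - g x) xs   ≡⟨ cong ((f x + - g x) +_) (∑ₗ-+- f g xs) ⟩
    (f x + - g x) + (∑ₗ f xs + - ∑ₗ g xs)       ≡⟨ interchange (f x) (- g x) (∑ₗ f xs) (- ∑ₗ g xs) ⟩
    (f x + ∑ₗ f xs) + (- g x + - ∑ₗ g xs)       ≡⟨ cong ((f x + ∑ₗ f xs) +_) (-‿+-comm (g x) (∑ₗ g xs)) ⟩
    (f x + ∑ₗ f xs) + - (g x + ∑ₗ g xs)         ∎
    where open ≡-Reasoning

  ∑ₗ-oneTo : ∀ (f : ℕ → A) m → ∑ₗ f (oneTo m) ≡ ∑ m (f ∘ suc)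
  ∑ₗ-oneTo f m = trans (∑ₗ-map f suc (upTo m)) (∑ₗ-applyUpTo (f ∘ suc) m id)

  Series : Set
  Series = ℕ → A

  infixl 6 _+ₛ_
  infixl 7 _*ₛ_
  infix  8 -ₛ_

  _+ₛ_ _*ₛ_ : Op₂ Series
  (F +ₛ G) s = F s + G s
  (F *ₛ G) s = ∑ (suc s) (λ i → F i * G (s ∸ i))

  -ₛ_ : Op₁ Series
  (-ₛ F) s = - F s

  monomial : A → ℕ → Series
  monomial c k s = [ k ≟ s ]∙ c

  κ : A → Series
  κ c = monomial c 0

  X : ℕ → Series
  X = monomial 1#

  0ₛ 1ₛ : Series
  0ₛ _ = 0#
  1ₛ = κ 1#

  ∑ₛ : ℕ → (ℕ → Series) → Series
  ∑ₛ n F s = ∑ n (λ i → F i s)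

  ∑ₗₛ : {B : Set} → (B → Series) → List B → Series
  ∑ₗₛ F xs s = ∑ₗ (λ x → F x s) xs

  infixr 8 [_]∙ₛ_
  [_]∙ₛ_ : {P : Set} → Dec P → Series → Series
  ([ p ]∙ₛ F) s = [ p ]∙ F s

  monomial-*ₛ : ∀ c k F s → (monomial c k *ₛ F) s ≡ [ k ≤? s ]∙ (c * F (s ∸ k))
  monomial-*ₛ c k F s with k ≤? s
  ... | yes k≤s = trans (∑-single (suc s) k (s≤s k≤s) off) (cong (_* F (s ∸ k)) ([]-yes (k ≟ k) refl c))
    where
    off : ∀ i → i < suc s → i ≢ k → monomial c k i * F (s ∸ i) ≡ 0#
    off i _ i≢k = trans (cong (_* F (s ∸ i)) ([]-no (k ≟ i) (i≢k ∘ sym) c)) (zeroˡ _)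
  ... | no k≰s = ∑-zero (suc s) vanish
    where
    vanish : ∀ i → i < suc s → monomial c k i * F (s ∸ i) ≡ 0#
    vanish i i≤s = trans (cong (_* F (s ∸ i)) ([]-no (k ≟ i) (λ { refl → k≰s (≤-pred i≤s) }) c)) (zeroˡ _)

  κ-*ₛ : ∀ c F s → (κ c *ₛ F) s ≡ c * F s
  κ-*ₛ c F s = monomial-*ₛ c 0 F s

  monomial-[] : ∀ {P : Set} (p : Dec P) a k F → monomial ([ p ]∙ a) k *ₛ F ≗ [ p ]∙ₛ (monomial a k *ₛ F)
  monomial-[] (yes _) a k F s = refl
  monomial-[] (no _)  a k F s =
    trans (monomial-*ₛ 0# k F s) (trans (cong ([ k ≤? s ]∙_) (zeroˡ (F (s ∸ k)))) ([]-0# (k ≤? s)))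

  X-*ₛ : ∀ k F s → (X k *ₛ F) s ≡ [ k ≤? s ]∙ F (s ∸ k)
  X-*ₛ k F s = trans (monomial-*ₛ 1# k F s) (cong ([ k ≤? s ]∙_) (*-identityˡ _))

  1ₛ-*ₛ : ∀ F → 1ₛ *ₛ F ≗ F
  1ₛ-*ₛ F s = trans (κ-*ₛ 1# F s) (*-identityˡ (F s))

  *ₛ-comm : ∀ F G → F *ₛ G ≗ G *ₛ F
  *ₛ-comm F G s = begin
    ∑ (suc s) (λ i → F i * G (s ∸ i))                 ≡⟨ ∑-reverse s _ ⟩
    ∑ (suc s) (λ i → F (s ∸ i) * G (s ∸ (s ∸ i)))     ≡⟨ ∑-cong (suc s) flip ⟩
    ∑ (suc s) (λ i → G i * F (s ∸ i))                 ∎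
    where
    open ≡-Reasoning
    flip : ∀ i → i < suc s → F (s ∸ i) * G (s ∸ (s ∸ i)) ≡ G i * F (s ∸ i)
    flip i i≤s = trans (*-comm _ _) (cong (λ j → G j * F (s ∸ i)) (m∸[m∸n]≡n (≤-pred i≤s)))

  *ₛ-assoc : ∀ F G H → (F *ₛ G) *ₛ H ≗ F *ₛ (G *ₛ H)
  *ₛ-assoc F G H s = begin
    ∑ (suc s) (λ i → ∑ (suc i) (λ j → F j * G (i ∸ j)) * H (s ∸ i))
      ≡⟨ ∑-cong (suc s) (λ i _ → trans (*-comm _ _) (∑-*ˡ (suc i) (H (s ∸ i)) _)) ⟩
    ∑ (suc s) (λ i → ∑ (suc i) (λ j → H (s ∸ i) * (F j * G (i ∸ j))))
      ≡⟨ ∑-triangle (suc s) (λ i j → H (s ∸ i) * (F j * G (i ∸ j))) ⟩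
    ∑ (suc s) (λ j → ∑ (suc s ∸ j) (λ k → H (s ∸ (j ℕ.+ k)) * (F j * G (j ℕ.+ k ∸ j))))
      ≡⟨ ∑-cong (suc s) (λ j j≤s → inner j (≤-pred j≤s)) ⟩
    ∑ (suc s) (λ j → F j * ∑ (suc (s ∸ j)) (λ k → G k * H (s ∸ j ∸ k))) ∎
    where
    open ≡-Reasoning
    inner : ∀ j → j ≤ s → ∑ (suc s ∸ j) (λ k → H (s ∸ (j ℕ.+ k)) * (F j * G (j ℕ.+ k ∸ j)))
                        ≡ F j * ∑ (suc (s ∸ j)) (λ k → G k * H (s ∸ j ∸ k))
    inner j j≤s = begin
      ∑ (suc s ∸ j) (λ k → H (s ∸ (j ℕ.+ k)) * (F j * G (j ℕ.+ k ∸ j)))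
        ≡⟨ cong (λ n → ∑ n (λ k → H (s ∸ (j ℕ.+ k)) * (F j * G (j ℕ.+ k ∸ j)))) (+-∸-assoc 1 j≤s) ⟩
      ∑ (suc (s ∸ j)) (λ k → H (s ∸ (j ℕ.+ k)) * (F j * G (j ℕ.+ k ∸ j)))
        ≡⟨ ∑-cong (suc (s ∸ j)) (λ k _ → reshape k) ⟩
      ∑ (suc (s ∸ j)) (λ k → F j * (G k * H (s ∸ j ∸ k)))
        ≡⟨ ∑-*ˡ (suc (s ∸ j)) (F j) _ ⟨
      F j * ∑ (suc (s ∸ j)) (λ k → G k * H (s ∸ j ∸ k)) ∎
      where
      reshape : ∀ k → H (s ∸ (j ℕ.+ k)) * (F j * G (j ℕ.+ k ∸ j)) ≡ F j * (G k * H (s ∸ j ∸ k))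
      reshape k = begin
        H (s ∸ (j ℕ.+ k)) * (F j * G (j ℕ.+ k ∸ j))
          ≡⟨ cong₂ (λ a b → H a * (F j * G b)) (sym (∸-+-assoc s j k)) (m+n∸m≡n j k) ⟩
        H (s ∸ j ∸ k) * (F j * G k)   ≡⟨ *-comm _ _ ⟩
        (F j * G k) * H (s ∸ j ∸ k)   ≡⟨ *-assoc _ _ _ ⟩
        F j * (G k * H (s ∸ j ∸ k))   ∎

  *ₛ-distribʳ : ∀ F G H → (G +ₛ H) *ₛ F ≗ G *ₛ F +ₛ H *ₛ F
  *ₛ-distribʳ F G H s =
    trans (∑-cong (suc s) (λ i _ → distribʳ (F (s ∸ i)) (G i) (H i))) (∑-+ (suc s) _ _)

  *ₛ-0ₛ : ∀ F → F *ₛ 0ₛ ≗ 0ₛ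
  *ₛ-0ₛ F s = ∑-zero (suc s) (λ i _ → zeroʳ (F i))

  *ₛ-∑ₛ : ∀ F n G → F *ₛ ∑ₛ n G ≗ ∑ₛ n (λ i → F *ₛ G i)
  *ₛ-∑ₛ F n G s = trans (∑-cong (suc s) (λ j _ → ∑-*ˡ n (F j) _)) (∑-swap (suc s) n _)

  *ₛ-cong≗ : ∀ {F F′ G G′} → F ≗ F′ → G ≗ G′ → F *ₛ G ≗ F′ *ₛ G′
  *ₛ-cong≗ F≗F′ G≗G′ s = ∑-cong (suc s) (λ i _ → cong₂ _*_ (F≗F′ i) (G≗G′ (s ∸ i)))

  *ₛ-distribˡ : ∀ F G H → F *ₛ (G +ₛ H) ≗ F *ₛ G +ₛ F *ₛ H
  *ₛ-distribˡ F G H s = begin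
    (F *ₛ (G +ₛ H)) s          ≡⟨ *ₛ-comm F (G +ₛ H) s ⟩
    ((G +ₛ H) *ₛ F) s          ≡⟨ *ₛ-distribʳ F G H s ⟩
    (G *ₛ F +ₛ H *ₛ F) s        ≡⟨ cong₂ _+_ (*ₛ-comm G F s) (*ₛ-comm H F s) ⟩
    (F *ₛ G +ₛ F *ₛ H) s        ∎
    where open ≡-Reasoning

  *ₛ-[]ₛ : ∀ {P : Set} (p : Dec P) F G → F *ₛ [ p ]∙ₛ G ≗ [ p ]∙ₛ (F *ₛ G)
  *ₛ-[]ₛ (yes _) F G s = refl
  *ₛ-[]ₛ (no _)  F G s = *ₛ-0ₛ F s

  *ₛ-∑ₗₛ : ∀ {B : Set} F (G : B → Series) xs → F *ₛ ∑ₗₛ G xs ≗ ∑ₗₛ (λ x → F *ₛ G x) xs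
  *ₛ-∑ₗₛ F G []       s = *ₛ-0ₛ F s
  *ₛ-∑ₗₛ F G (x ∷ xs) s = trans (*ₛ-distribˡ F (G x) (∑ₗₛ G xs) s) (cong ((F *ₛ G x) s +_) (*ₛ-∑ₗₛ F G xs s))

  monomial-mul : ∀ a b j k → monomial a j *ₛ monomial b k ≗ monomial (a * b) (j ℕ.+ k)
  monomial-mul a b j k s = trans (monomial-*ₛ a j (monomial b k) s) (product (j ≤? s))
    where
    product : (j≤?s : Dec (j ≤ s)) → [ j≤?s ]∙ (a * monomial b k (s ∸ j)) ≡ monomial (a * b) (j ℕ.+ k) s
    product (no j≰s) = sym ([]-no (j ℕ.+ k ≟ s) (λ { refl → j≰s (m≤m+n j k) }) (a * b))
    product (yes j≤s) = trans (*-[] (k ≟ s ∸ j) a b)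
      ([]-⇔ (λ { refl → m+[n∸m]≡n j≤s }) (λ { refl → sym (m+n∸m≡n j k) }) (k ≟ s ∸ j) (j ℕ.+ k ≟ s) (a * b))

  monomial-+ : ∀ a b k → monomial a k +ₛ monomial b k ≗ monomial (a + b) k
  monomial-+ a b k s with k ≟ s
  ... | yes _ = refl
  ... | no  _ = +-identityʳ 0#

  monomial-neg-*ₛ : ∀ a k F → monomial (- a) k *ₛ F ≗ -ₛ (monomial a k *ₛ F)
  monomial-neg-*ₛ a k F s = begin
    (monomial (- a) k *ₛ F) s          ≡⟨ monomial-*ₛ (- a) k F s ⟩
    [ k ≤? s ]∙ (- a * F (s ∸ k))      ≡⟨ cong ([ k ≤? s ]∙_) (sym (-‿distribˡ-* a (F (s ∸ k)))) ⟩
    [ k ≤? s ]∙ - (a * F (s ∸ k))      ≡⟨ []-neg (k ≤? s) (a * F (s ∸ k)) ⟩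
    - [ k ≤? s ]∙ (a * F (s ∸ k))      ≡⟨ cong -_ (monomial-*ₛ a k F s) ⟨
    - (monomial a k *ₛ F) s            ∎
    where
    open ≡-Reasoning
    []-neg : {P : Set} (p : Dec P) → ∀ b → [ p ]∙ - b ≡ - [ p ]∙ b
    []-neg (yes _) b = refl
    []-neg (no _)  b = sym -0#≈0#

  monomial-0# : ∀ k → monomial 0# k ≗ 0ₛ
  monomial-0# k s with k ≟ s
  ... | yes _ = refl
  ... | no  _ = refl

  -- Agreement up to degree N; a record rather than a function so that F and G can be inferred.
  infix 4 _≈[_]_
  record _≈[_]_ (F : Series) (N : ℕ) (G : Series) : Set where
    constructor agree
    field coefficient : ∀ s → s ≤ N → F s ≡ G s
  open _≈[_]_ public

  ≗⇒≈ : ∀ {F G N} → F ≗ G → F ≈[ N ] G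
  ≗⇒≈ F≗G = agree (λ s _ → F≗G s)

  ≈-weaken : ∀ {F G M N} → M ≤ N → F ≈[ N ] G → F ≈[ M ] G
  ≈-weaken M≤N F≈G = agree (λ s s≤M → coefficient F≈G s (≤-trans s≤M M≤N))

  X-big : ∀ {N} k → N < k → X k ≈[ N ] 0ₛ
  X-big k N<k = agree (λ s s≤N → []-no (k ≟ s) (λ { refl → <-irrefl refl (≤-<-trans s≤N N<k) }) 1#)

  cancel-unit : ∀ N C {F G} → C 0 ≡ 1# → C *ₛ F ≈[ N ] C *ₛ G → F ≈[ N ] G
  cancel-unit zero C {F} {G} C₀≡1 CF≈CG = agree λ { s z≤n → begin
    F 0           ≡⟨ *-identityˡ (F 0) ⟨
    1# * F 0      ≡⟨ cong (_* F 0) C₀≡1 ⟨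
    C 0 * F 0     ≡⟨ +-identityˡ _ ⟨
    (C *ₛ F) 0    ≡⟨ coefficient CF≈CG 0 z≤n ⟩
    (C *ₛ G) 0    ≡⟨ +-identityˡ _ ⟩
    C 0 * G 0     ≡⟨ cong (_* G 0) C₀≡1 ⟩
    1# * G 0      ≡⟨ *-identityˡ (G 0) ⟩
    G 0           ∎ }
    where open ≡-Reasoning
  cancel-unit (suc N) C {F} {G} C₀≡1 CF≈CG = agree extend
    where
    open ≡-Reasoning
    F≈[N]G : F ≈[ N ] G
    F≈[N]G = cancel-unit N C C₀≡1 (≈-weaken (m≤n⇒m≤1+n ≤-refl) CF≈CG)
    s : ℕ
    s = suc N
    top : ∀ H → H s * C (s ∸ s) ≡ H s
    top H = trans (cong (λ j → H s * C j) (n∸n≡0 s)) (trans (cong (H s *_) C₀≡1) (*-identityʳ (H s)))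
    leading : ∑ s (λ i → G i * C (s ∸ i)) + F s * C (s ∸ s) ≡ ∑ s (λ i → G i * C (s ∸ i)) + G s * C (s ∸ s)
    leading = begin
      ∑ s (λ i → G i * C (s ∸ i)) + F s * C (s ∸ s)
        ≡⟨ cong (_+ F s * C (s ∸ s)) (∑-cong s (λ i i<s → cong (_* C (s ∸ i)) (coefficient F≈[N]G i (≤-pred i<s)))) ⟨
      (F *ₛ C) s    ≡⟨ *ₛ-comm F C s ⟩
      (C *ₛ F) s    ≡⟨ coefficient CF≈CG s ≤-refl ⟩
      (C *ₛ G) s    ≡⟨ *ₛ-comm C G s ⟩
      (G *ₛ C) s    ∎
    extend : ∀ t → t ≤ suc N → F t ≡ G t
    extend t t≤1+N with m≤n⇒m<n∨m≡n t≤1+N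
    ... | inj₁ t<1+N = coefficient F≈[N]G t (≤-pred t<1+N)
    ... | inj₂ refl = begin
      F s               ≡⟨ top F ⟨
      F s * C (s ∸ s)   ≡⟨ +-cancelˡ (∑ s (λ i → G i * C (s ∸ i))) _ _ leading ⟩
      G s * C (s ∸ s)   ≡⟨ top G ⟩
      G s               ∎

  ∏ : ℕ → (ℕ → Series) → Series
  ∏ zero    f = 1ₛ
  ∏ (suc n) f = ∏ n f *ₛ f (suc n)

  ∏-constant-term : ∀ n f → (∀ t → 1 ≤ t → f t 0 ≡ 1#) → ∏ n f 0 ≡ 1#
  ∏-constant-term zero    f f₀≡1 = refl
  ∏-constant-term (suc n) f f₀≡1 = begin
    (∏ n f *ₛ f (suc n)) 0     ≡⟨ +-identityˡ _ ⟩
    ∏ n f 0 * f (suc n) 0      ≡⟨ cong₂ _*_ (∏-constant-term n f f₀≡1) (f₀≡1 (suc n) (s≤s z≤n)) ⟩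
    1# * 1#                    ≡⟨ *-identityʳ 1# ⟩
    1#                         ∎
    where open ≡-Reasoning

  module Truncated (N : ℕ) where

    infix 4 _≈_
    _≈_ : Series → Series → Set
    F ≈ G = F ≈[ N ] G

    isCommutativeRingₛ : IsCommutativeRing _≈_ _+ₛ_ _*ₛ_ -ₛ_ 0ₛ 1ₛ
    isCommutativeRingₛ = record
      { isRing = record
        { +-isAbelianGroup = record
          { isGroup = record
            { isMonoid = record
              { isSemigroup = record
                { isMagma = record
                  { isEquivalence = record
                    { refl  = agree (λ _ _ → refl)
                    ; sym   = λ F≈G → agree (λ s s≤N → sym (coefficient F≈G s s≤N))
                    ; trans = λ F≈G G≈H → agree (λ s s≤N → trans (coefficient F≈G s s≤N) (coefficient G≈H s s≤N)) }
                  ; ∙-cong = λ F≈F′ G≈G′ → agree (λ s s≤N →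
                      cong₂ _+_ (coefficient F≈F′ s s≤N) (coefficient G≈G′ s s≤N)) }
                ; assoc = λ F G H → ≗⇒≈ (λ s → +-assoc (F s) (G s) (H s)) }
              ; identity = (λ F → ≗⇒≈ (λ s → +-identityˡ (F s))) , (λ F → ≗⇒≈ (λ s → +-identityʳ (F s))) }
            ; inverse = (λ F → ≗⇒≈ (λ s → -‿inverseˡ (F s))) , (λ F → ≗⇒≈ (λ s → -‿inverseʳ (F s)))
            ; ⁻¹-cong = λ F≈F′ → agree (λ s s≤N → cong -_ (coefficient F≈F′ s s≤N)) }
          ; comm = λ F G → ≗⇒≈ (λ s → +-comm (F s) (G s)) }
        ; *-cong = λ F≈F′ G≈G′ → agree (λ s s≤N → ∑-cong (suc s) (λ i i≤s →
            cong₂ _*_ (coefficient F≈F′ i (≤-trans (≤-pred i≤s) s≤N))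
                      (coefficient G≈G′ (s ∸ i) (≤-trans (m∸n≤m s i) s≤N))))
        ; *-assoc = λ F G H → ≗⇒≈ (*ₛ-assoc F G H)
        ; *-identity = (λ F → ≗⇒≈ (1ₛ-*ₛ F)) , (λ F → ≗⇒≈ (λ s → trans (*ₛ-comm F 1ₛ s) (1ₛ-*ₛ F s)))
        ; distrib = (λ F G H → ≗⇒≈ (*ₛ-distribˡ F G H)) , (λ F G H → ≗⇒≈ (*ₛ-distribʳ F G H)) }
      ; *-comm = λ F G → ≗⇒≈ (*ₛ-comm F G) }

    seriesRing : CommutativeRing 0ℓ 0ℓ
    seriesRing = record { isCommutativeRing = isCommutativeRingₛ }

    open CommutativeRing seriesRing public
      using ()
      renaming (setoid to ≈-setoid; refl to ≈-refl; sym to ≈-sym; trans to ≈-trans;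
                +-cong to +ₛ-cong; *-cong to *ₛ-cong;
                *-assoc to *ₛ-assocₜ; *-comm to *ₛ-commₜ;
                *-identityˡ to *ₛ-identityˡ; *-identityʳ to *ₛ-identityʳ;
                +-identityʳ to +ₛ-identityʳ; +-assoc to +ₛ-assoc; -‿inverseʳ to +ₛ-inverseʳ;
                zeroˡ to *ₛ-zeroˡ; zeroʳ to *ₛ-zeroʳ)
    -- Normal forms are compared by ≈-refl, so the solver proves only identities without
    -- cancellation; subtractions are done by hand.
    open import Tactic.RingSolver.NonReflective (fromCommutativeRing seriesRing (λ _ → nothing)) public
      using (solve; _⊜_)
    open import Tactic.RingSolver.Core.Expression public using (_⊕_; _⊗_)
    open import Relation.Binary.Reasoning.Setoid ≈-setoid public

    +ₛ-congˡ : ∀ F {G H} → G ≈ H → F +ₛ G ≈ F +ₛ H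
    +ₛ-congˡ F = +ₛ-cong (≈-refl {F})

    +ₛ-congʳ : ∀ F {G H} → G ≈ H → G +ₛ F ≈ H +ₛ F
    +ₛ-congʳ F G≈H = +ₛ-cong G≈H (≈-refl {F})

    *ₛ-congˡ : ∀ F {G H} → G ≈ H → F *ₛ G ≈ F *ₛ H
    *ₛ-congˡ F = *ₛ-cong (≈-refl {F})

    *ₛ-congʳ : ∀ F {G H} → G ≈ H → G *ₛ F ≈ H *ₛ F
    *ₛ-congʳ F G≈H = *ₛ-cong G≈H (≈-refl {F})

    ∑ₛ-cong : ∀ n F G → (∀ i → i < n → F i ≈ G i) → ∑ₛ n F ≈ ∑ₛ n G
    ∑ₛ-cong n F G F≈G = agree (λ s s≤N → ∑-cong n (λ i i<n → coefficient (F≈G i i<n) s s≤N))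

    ∏-cong : ∀ n {f g} → (∀ t → 1 ≤ t → t ≤ n → f t ≈ g t) → ∏ n f ≈ ∏ n g
    ∏-cong zero    f≈g = ≈-refl
    ∏-cong (suc n) f≈g =
      *ₛ-cong (∏-cong n (λ t 1≤t t≤n → f≈g t 1≤t (m≤n⇒m≤1+n t≤n))) (f≈g (suc n) (s≤s z≤n) ≤-refl)

    ∏-*ₛ : ∀ n f g → ∏ n (λ t → f t *ₛ g t) ≈ ∏ n f *ₛ ∏ n g
    ∏-*ₛ zero    f g = ≈-sym (*ₛ-identityˡ 1ₛ)
    ∏-*ₛ (suc n) f g = begin
      ∏ n (λ t → f t *ₛ g t) *ₛ (f (suc n) *ₛ g (suc n))
        ≈⟨ *ₛ-congʳ (f (suc n) *ₛ g (suc n)) (∏-*ₛ n f g) ⟩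
      (∏ n f *ₛ ∏ n g) *ₛ (f (suc n) *ₛ g (suc n))
        ≈⟨ solve 4 (λ a b c d → (a ⊗ b) ⊗ (c ⊗ d) ⊜ (a ⊗ c) ⊗ (b ⊗ d)) ≈-refl
                   (∏ n f) (∏ n g) (f (suc n)) (g (suc n)) ⟩
      (∏ n f *ₛ f (suc n)) *ₛ (∏ n g *ₛ g (suc n)) ∎

    ∏-trivial-tail : ∀ M K f → K ≤ M → (∀ t → K < t → t ≤ M → f t ≈ 1ₛ) → ∏ M f ≈ ∏ K f
    ∏-trivial-tail zero    K f K≤0 trivial with n≤0⇒n≡0 K≤0
    ... | refl = ≈-refl
    ∏-trivial-tail (suc M) K f K≤1+M trivial with m≤n⇒m<n∨m≡n K≤1+M
    ... | inj₂ refl = ≈-refl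
    ... | inj₁ K<1+M = begin
      ∏ M f *ₛ f (suc M)
        ≈⟨ *ₛ-cong (∏-trivial-tail M K f (≤-pred K<1+M) (λ t K<t t≤M → trivial t K<t (m≤n⇒m≤1+n t≤M)))
                   (trivial (suc M) K<1+M ≤-refl) ⟩
      ∏ K f *ₛ 1ₛ         ≈⟨ *ₛ-identityʳ (∏ K f) ⟩
      ∏ K f               ∎

  κ-+ : ∀ a b → κ a +ₛ κ b ≗ κ (a + b)
  κ-+ a b = monomial-+ a b 0

  κ-* : ∀ a b → κ a *ₛ κ b ≗ κ (a * b)
  κ-* a b = monomial-mul a b 0 0

  monomial≗κ*X : ∀ c k → monomial c k ≗ κ c *ₛ X k
  monomial≗κ*X c k s = trans (cong (λ a → monomial a k s) (sym (*-identityʳ c))) (sym (monomial-mul c 1# 0 k s))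

  X-+ : ∀ j k → X j *ₛ X k ≗ X (j ℕ.+ k)
  X-+ j k s = trans (monomial-mul 1# 1# j k s) (cong (λ a → monomial a (j ℕ.+ k) s) (*-identityˡ 1#))

  binomial : A → ℕ → Series
  binomial c k = 1ₛ +ₛ monomial c k

  binomial-constant-term : ∀ c k → 1 ≤ k → binomial c k 0 ≡ 1#
  binomial-constant-term c (suc k) _ = +-identityʳ 1#

  module _ {N : ℕ} where
    open Truncated N

    1+-*ₛ-1+ : ∀ F G → (1ₛ +ₛ F) *ₛ (1ₛ +ₛ G) ≈ 1ₛ +ₛ F +ₛ G +ₛ F *ₛ G
    1+-*ₛ-1+ F G = begin
      (1ₛ +ₛ F) *ₛ (1ₛ +ₛ G)
        ≈⟨ solve 3 (λ o f g → (o ⊕ f) ⊗ (o ⊕ g) ⊜ (o ⊗ o ⊕ o ⊗ g ⊕ o ⊗ f ⊕ f ⊗ g)) ≈-refl 1ₛ F G ⟩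
      1ₛ *ₛ 1ₛ +ₛ 1ₛ *ₛ G +ₛ 1ₛ *ₛ F +ₛ F *ₛ G
        ≈⟨ +ₛ-congʳ (F *ₛ G) (+ₛ-cong (+ₛ-cong (*ₛ-identityˡ 1ₛ) (*ₛ-identityˡ G)) (*ₛ-identityˡ F)) ⟩
      1ₛ +ₛ G +ₛ F +ₛ F *ₛ G
        ≈⟨ solve 4 (λ o f g h → (o ⊕ g ⊕ f ⊕ h) ⊜ (o ⊕ f ⊕ g ⊕ h)) ≈-refl 1ₛ F G (F *ₛ G) ⟩
      1ₛ +ₛ F +ₛ G +ₛ F *ₛ G ∎

    binomial-*ₛ : ∀ a b k {c d} → a + b ≡ c → a * b ≡ d →
      binomial a k *ₛ binomial b k ≈ 1ₛ +ₛ monomial c k +ₛ monomial d (k ℕ.+ k)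
    binomial-*ₛ a b k refl refl = begin
      binomial a k *ₛ binomial b k
        ≈⟨ 1+-*ₛ-1+ (monomial a k) (monomial b k) ⟩
      1ₛ +ₛ monomial a k +ₛ monomial b k +ₛ monomial a k *ₛ monomial b k
        ≈⟨ +ₛ-cong (≈-trans (+ₛ-assoc 1ₛ (monomial a k) (monomial b k)) (+ₛ-congˡ 1ₛ (≗⇒≈ (monomial-+ a b k))))
                   (≗⇒≈ (monomial-mul a b k k)) ⟩
      1ₛ +ₛ monomial (a + b) k +ₛ monomial (a * b) (k ℕ.+ k) ∎

    +ₛ-monomial-0# : ∀ F k → F +ₛ monomial 0# k ≈ F
    +ₛ-monomial-0# F k = ≈-trans (+ₛ-congˡ F (≗⇒≈ (monomial-0# k))) (+ₛ-identityʳ F)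

    1+monomial-0# : ∀ k F → 1ₛ +ₛ monomial 0# k +ₛ F ≈ 1ₛ +ₛ F
    1+monomial-0# k F = +ₛ-congʳ F (+ₛ-monomial-0# 1ₛ k)

    binomial-high : ∀ c k → N < k → binomial c k ≈ 1ₛ
    binomial-high c k N<k = begin
      1ₛ +ₛ monomial c k     ≈⟨ +ₛ-congˡ 1ₛ (≗⇒≈ (monomial≗κ*X c k)) ⟩
      1ₛ +ₛ κ c *ₛ X k       ≈⟨ +ₛ-congˡ 1ₛ (≈-trans (*ₛ-congˡ (κ c) (X-big k N<k)) (*ₛ-zeroʳ (κ c))) ⟩
      1ₛ +ₛ 0ₛ               ≈⟨ +ₛ-identityʳ 1ₛ ⟩
      1ₛ                     ∎

  monomial-*ₛ-vanishes : ∀ c x F k s → 1 ≤ x → (∀ s′ → s′ < k → F s′ ≡ 0#) → s < suc k →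
                         (monomial c x *ₛ F) s ≡ 0#
  monomial-*ₛ-vanishes c x F k s 1≤x F<k≡0 s≤k = trans (monomial-*ₛ c x F s) (vanish (x ≤? s))
    where
    vanish : (x≤?s : Dec (x ≤ s)) → [ x≤?s ]∙ (c * F (s ∸ x)) ≡ 0#
    vanish (no _)    = refl
    vanish (yes x≤s) = trans (cong (c *_) (F<k≡0 (s ∸ x) (below x≤s 1≤x (≤-pred s≤k)))) (zeroʳ c)
      where
      below : ∀ {x s k} → x ≤ s → 1 ≤ x → s ≤ k → s ∸ x < k
      below {suc x} {suc s} (s≤s x≤s) _ 1+s≤k = <-≤-trans (s≤s (m∸n≤m s x)) 1+s≤k

  module WeightedChains {R : ℕ → ℕ → Set} (R? : ∀ t x → Dec (R t x)) (w : ℕ → A) where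

    weight : List ℕ → A
    weight []       = 1#
    weight (x ∷ xs) = w x * weight xs

    Chain : ℕ → List ℕ → Set
    Chain s xs = Linked R xs × All (1 ≤_) xs × sum xs ≡ s

    chain? : ∀ s xs → Dec (Chain s xs)
    chain? s xs = linked? R? xs ×-dec (all? (1 ≤?_) xs ×-dec (sum xs ℕ.≟ s))

    ChainBelow : ℕ → ℕ → List ℕ → Set
    ChainBelow t s xs = Linked R (t ∷ xs) × All (1 ≤_) xs × sum xs ≡ s

    chainBelow? : ∀ t s xs → Dec (ChainBelow t s xs)
    chainBelow? t s xs = linked? R? (t ∷ xs) ×-dec (all? (1 ≤?_) xs ×-dec (sum xs ℕ.≟ s))

    chainSeries : ℕ → List ℕ → Series
    chainSeries t xs s = [ chainBelow? t s xs ]∙ weight xs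

    chainSeries-∷ : ∀ t x xs →
      chainSeries t (x ∷ xs) ≗ monomial ([ 1 ≤? x ×-dec R? t x ]∙ w x) x *ₛ chainSeries x xs
    chainSeries-∷ t x xs s = sym (begin
      (monomial ([ pos×R ]∙ w x) x *ₛ chainSeries x xs) s
        ≡⟨ monomial-*ₛ _ x (chainSeries x xs) s ⟩
      [ x ≤? s ]∙ (([ pos×R ]∙ w x) * ([ rest ]∙ weight xs))
        ≡⟨ cong ([ x ≤? s ]∙_) ([]-*-[] pos×R rest (w x) (weight xs)) ⟩
      [ x ≤? s ]∙ [ rest ]∙ [ pos×R ]∙ weight (x ∷ xs)
        ≡⟨ trans (cong ([ x ≤? s ]∙_) ([]-×-dec rest pos×R _)) ([]-×-dec (x ≤? s) (rest ×-dec pos×R) _) ⟩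
      [ x ≤? s ×-dec (rest ×-dec pos×R) ]∙ weight (x ∷ xs)
        ≡⟨ []-⇔ join split _ (chainBelow? t s (x ∷ xs)) _ ⟩
      chainSeries t (x ∷ xs) s ∎)
      where
      open ≡-Reasoning
      pos×R : Dec (1 ≤ x × R t x)
      pos×R = 1 ≤? x ×-dec R? t x
      rest : Dec (ChainBelow x (s ∸ x) xs)
      rest = chainBelow? x (s ∸ x) xs
      join : x ≤ s × ChainBelow x (s ∸ x) xs × 1 ≤ x × R t x → ChainBelow t s (x ∷ xs)
      join (x≤s , (lk , pos , Σ≡) , 1≤x , r) = r ∷ lk , 1≤x ∷ pos , trans (cong (x ℕ.+_) Σ≡) (m+[n∸m]≡n x≤s)
      split : ChainBelow t s (x ∷ xs) → x ≤ s × ChainBelow x (s ∸ x) xs × 1 ≤ x × R t x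
      split (r ∷ lk , 1≤x ∷ pos , refl) = m≤m+n x (sum xs) , (lk , pos , sym (m+n∸m≡n x (sum xs))) , 1≤x , r

    linked-below : ∀ {t xs} → (∀ x → 1 ≤ x → x ≤ sum xs → R t x) → All (1 ≤_) xs → Linked R xs → Linked R (t ∷ xs)
    linked-below {xs = []}     _     _         _  = [-]
    linked-below {xs = x ∷ xs} below (1≤x ∷ _) lk = below x 1≤x (m≤m+n x (sum xs)) ∷ lk

    link-weight : ℕ → ℕ → A
    link-weight t x = [ R? t x ]∙ w x

    module _ (m : ℕ) where

      layer : ℕ → ℕ → Series
      layer k t = ∑ₗₛ (chainSeries t) (listsOfLength k m)

      generating : ℕ → Series
      generating t = ∑ₛ (suc m) (λ k → layer k t)

      layer-zero : ∀ t → layer 0 t ≗ 1ₛ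
      layer-zero t s = trans (+-identityʳ _) ([]-⇔ (λ (_ , _ , 0≡s) → 0≡s) (λ 0≡s → [-] , [] , 0≡s)
                                                  (chainBelow? t s []) (0 ≟ s) 1#)

      layer-suc : ∀ k t → layer (suc k) t ≗ ∑ₛ m (λ i → monomial (link-weight t (suc i)) (suc i) *ₛ layer k (suc i))
      layer-suc k t s = begin
        ∑ₗ (λ xs → chainSeries t xs s) (concatMap (λ x → map (x ∷_) (listsOfLength k m)) (oneTo m))
          ≡⟨ ∑ₗ-concatMap _ (λ x → map (x ∷_) (listsOfLength k m)) (oneTo m) ⟩
        ∑ₗ (λ x → ∑ₗ (λ xs → chainSeries t xs s) (map (x ∷_) (listsOfLength k m))) (oneTo m)
          ≡⟨ ∑ₗ-oneTo _ m ⟩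
        ∑ m (λ i → ∑ₗ (λ xs → chainSeries t xs s) (map (suc i ∷_) (listsOfLength k m)))
          ≡⟨ ∑-cong m (λ i _ → prepend i) ⟩
        ∑ m (λ i → (monomial (link-weight t (suc i)) (suc i) *ₛ layer k (suc i)) s) ∎
        where
        open ≡-Reasoning
        prepend : ∀ i → ∑ₗ (λ xs → chainSeries t xs s) (map (suc i ∷_) (listsOfLength k m))
                      ≡ (monomial (link-weight t (suc i)) (suc i) *ₛ layer k (suc i)) s
        prepend i = begin
          ∑ₗ (λ xs → chainSeries t xs s) (map (suc i ∷_) (listsOfLength k m))
            ≡⟨ ∑ₗ-map _ (suc i ∷_) (listsOfLength k m) ⟩
          ∑ₗ (λ xs → chainSeries t (suc i ∷ xs) s) (listsOfLength k m)
            ≡⟨ ∑ₗ-cong (listsOfLength k m) (λ xs → trans (chainSeries-∷ t (suc i) xs s)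
                 (cong (λ c → (monomial c (suc i) *ₛ chainSeries (suc i) xs) s)
                   ([]-⇔ proj₂ (s≤s z≤n ,_) (1 ≤? suc i ×-dec R? t (suc i)) (R? t (suc i)) (w (suc i))))) ⟩
          ∑ₗ (λ xs → (monomial (link-weight t (suc i)) (suc i) *ₛ chainSeries (suc i) xs) s) (listsOfLength k m)
            ≡⟨ *ₛ-∑ₗₛ _ (chainSeries (suc i)) (listsOfLength k m) s ⟨
          (monomial (link-weight t (suc i)) (suc i) *ₛ layer k (suc i)) s ∎

      layer-vanishes : ∀ k t s → s < k → layer k t s ≡ 0#
      layer-vanishes (suc k) t s s<1+k = trans (layer-suc k t s) (∑-zero m (λ i _ →
        monomial-*ₛ-vanishes _ (suc i) (layer k (suc i)) k s (s≤s z≤n) (layer-vanishes k (suc i)) s<1+k))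

      private
        attach : ℕ → ℕ → Series
        attach t i = monomial (link-weight t (suc i)) (suc i)

      generating-unfold≗ : ∀ t → generating t ≗ 1ₛ +ₛ ∑ₛ m (λ i → attach t i *ₛ ∑ₛ m (λ k → layer k (suc i)))
      generating-unfold≗ t s = begin
        ∑ (suc m) (λ k → layer k t s)
          ≡⟨ ∑-head m (λ k → layer k t s) ⟩
        layer 0 t s + ∑ m (λ k → layer (suc k) t s)
          ≡⟨ cong₂ _+_ (layer-zero t s) (∑-cong m (λ k _ → layer-suc k t s)) ⟩
        1ₛ s + ∑ m (λ k → ∑ m (λ i → (attach t i *ₛ layer k (suc i)) s))
          ≡⟨ cong (1ₛ s +_) (∑-swap m m (λ k i → (attach t i *ₛ layer k (suc i)) s)) ⟩
        1ₛ s + ∑ m (λ i → ∑ m (λ k → (attach t i *ₛ layer k (suc i)) s))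
          ≡⟨ cong (1ₛ s +_) (∑-cong m (λ i _ → *ₛ-∑ₛ (attach t i) m (λ k → layer k (suc i)) s)) ⟨
        1ₛ s + ∑ m (λ i → (attach t i *ₛ ∑ₛ m (λ k → layer k (suc i))) s) ∎
        where open ≡-Reasoning

      generating-unfold : ∀ t → generating t ≈[ m ] 1ₛ +ₛ ∑ₛ m (λ i → attach t i *ₛ generating (suc i))
      generating-unfold t = ≈-trans (≗⇒≈ (generating-unfold≗ t))
        (+ₛ-congˡ 1ₛ (∑ₛ-cong m _ _ (λ i _ → ≈-sym (drop-longest i))))
        where
        open Truncated m
        drop-longest : ∀ i → attach t i *ₛ generating (suc i) ≈ attach t i *ₛ ∑ₛ m (λ k → layer k (suc i))
        drop-longest i = begin
          attach t i *ₛ (∑ₛ m (λ k → layer k (suc i)) +ₛ layer m (suc i))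
            ≈⟨ ≗⇒≈ (*ₛ-distribˡ (attach t i) (∑ₛ m (λ k → layer k (suc i))) (layer m (suc i))) ⟩
          attach t i *ₛ ∑ₛ m (λ k → layer k (suc i)) +ₛ attach t i *ₛ layer m (suc i)
            ≈⟨ +ₛ-congˡ _ (agree (λ s s≤m → monomial-*ₛ-vanishes _ (suc i) (layer m (suc i)) m s (s≤s z≤n)
                                                 (layer-vanishes m (suc i)) (s≤s s≤m))) ⟩
          attach t i *ₛ ∑ₛ m (λ k → layer k (suc i)) +ₛ 0ₛ
            ≈⟨ +ₛ-identityʳ _ ⟩
          attach t i *ₛ ∑ₛ m (λ k → layer k (suc i)) ∎

      generating-trivial : ∀ t → (∀ i → ¬ R t (suc i)) → generating t ≈[ m ] 1ₛ
      generating-trivial t ¬R = begin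
        generating t                                             ≈⟨ generating-unfold t ⟩
        1ₛ +ₛ ∑ₛ m (λ i → attach t i *ₛ generating (suc i))           ≈⟨ +ₛ-congˡ 1ₛ (≗⇒≈ no-terms) ⟩
        1ₛ +ₛ 0ₛ                                                 ≈⟨ +ₛ-identityʳ 1ₛ ⟩
        1ₛ                                                       ∎
        where
        open Truncated m
        no-terms : ∑ₛ m (λ i → attach t i *ₛ generating (suc i)) ≗ 0ₛ
        no-terms s = ∑-zero m (λ i _ → trans (monomial-[] (R? t (suc i)) (w (suc i)) (suc i) (generating (suc i)) s)
                                             ([]-no (R? t (suc i)) (¬R i) _))

      module _ {t t′ c′ : ℕ} (to : ∀ y → R t′ y → R t y ⊎ y ≡ suc c′)
               (from : ∀ y → R t y ⊎ y ≡ suc c′ → R t′ y) (¬Rtc : ¬ R t (suc c′)) where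

        private
          c : ℕ
          c = suc c′

        link-weight-split : ∀ y → link-weight t′ y ≡ link-weight t y + [ y ≟ c ]∙ w y
        link-weight-split y with R? t′ y | R? t y | y ≟ c
        ... | yes _   | yes _  | no _     = sym (+-identityʳ (w y))
        ... | yes _   | yes r  | yes refl = ⊥-elim (¬Rtc r)
        ... | yes _   | no _   | yes _    = sym (+-identityˡ (w y))
        ... | yes r′  | no ¬r  | no y≢c   = ⊥-elim ([ ¬r , y≢c ] (to y r′))
        ... | no ¬r′  | yes r  | _        = ⊥-elim (¬r′ (from y (inj₁ r)))
        ... | no ¬r′  | no _   | yes y≡c  = ⊥-elim (¬r′ (from y (inj₂ y≡c)))
        ... | no _    | no _   | no _     = sym (+-identityʳ 0#)

        split-terms : c ≤ m → ∀ (G : ℕ → Series) → ∑ₛ m (λ i → attach t′ i *ₛ G (suc i))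
                    ≗ ∑ₛ m (λ i → attach t i *ₛ G (suc i)) +ₛ monomial (w c) c *ₛ G c
        split-terms c≤m G s = begin
          ∑ m (λ i → (attach t′ i *ₛ G (suc i)) s)
            ≡⟨ ∑-cong m (λ i _ → split i) ⟩
          ∑ m (λ i → (attach t i *ₛ G (suc i)) s + (monomial ([ suc i ≟ c ]∙ w (suc i)) (suc i) *ₛ G (suc i)) s)
            ≡⟨ ∑-+ m _ _ ⟩
          ∑ m (λ i → (attach t i *ₛ G (suc i)) s)
            + ∑ m (λ i → (monomial ([ suc i ≟ c ]∙ w (suc i)) (suc i) *ₛ G (suc i)) s)
            ≡⟨ cong (∑ m (λ i → (attach t i *ₛ G (suc i)) s) +_) selected ⟩
          ∑ m (λ i → (attach t i *ₛ G (suc i)) s) + (monomial (w c) c *ₛ G c) s ∎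
          where
          open ≡-Reasoning
          split : ∀ i → (attach t′ i *ₛ G (suc i)) s
                      ≡ (attach t i *ₛ G (suc i)) s + (monomial ([ suc i ≟ c ]∙ w (suc i)) (suc i) *ₛ G (suc i)) s
          split i = begin
            (monomial (link-weight t′ (suc i)) (suc i) *ₛ G (suc i)) s
              ≡⟨ cong (λ a → (monomial a (suc i) *ₛ G (suc i)) s) (link-weight-split (suc i)) ⟩
            (monomial (link-weight t (suc i) + [ suc i ≟ c ]∙ w (suc i)) (suc i) *ₛ G (suc i)) s
              ≡⟨ *ₛ-cong≗ {G = G (suc i)} (λ j → sym (monomial-+ _ _ (suc i) j)) (λ _ → refl) s ⟩
            ((attach t i +ₛ monomial ([ suc i ≟ c ]∙ w (suc i)) (suc i)) *ₛ G (suc i)) s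
              ≡⟨ *ₛ-distribʳ (G (suc i)) (attach t i) _ s ⟩
            (attach t i *ₛ G (suc i)) s + (monomial ([ suc i ≟ c ]∙ w (suc i)) (suc i) *ₛ G (suc i)) s ∎
          selected : ∑ m (λ i → (monomial ([ suc i ≟ c ]∙ w (suc i)) (suc i) *ₛ G (suc i)) s)
                   ≡ (monomial (w c) c *ₛ G c) s
          selected = begin
            ∑ m (λ i → (monomial ([ suc i ≟ c ]∙ w (suc i)) (suc i) *ₛ G (suc i)) s)
              ≡⟨ ∑-single m c′ c≤m (λ i _ i≢c′ →
                   trans (monomial-[] (suc i ≟ c) (w (suc i)) (suc i) (G (suc i)) s)
                         ([]-no (suc i ≟ c) (i≢c′ ∘ suc-injective) _)) ⟩
            (monomial ([ c ≟ c ]∙ w c) c *ₛ G c) s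
              ≡⟨ cong (λ a → (monomial a c *ₛ G c) s) ([]-yes (c ≟ c) refl (w c)) ⟩
            (monomial (w c) c *ₛ G c) s ∎

        generating-column : c ≤ m → generating t′ ≈[ m ] generating t +ₛ monomial (w c) c *ₛ generating c
        generating-column c≤m = begin
          generating t′                  ≈⟨ generating-unfold t′ ⟩
          1ₛ +ₛ ∑ₛ m (λ i → attach t′ i *ₛ generating (suc i))
                                         ≈⟨ +ₛ-congˡ 1ₛ (≗⇒≈ (split-terms c≤m generating)) ⟩
          1ₛ +ₛ (lower +ₛ new)           ≈⟨ ≗⇒≈ (λ s → sym (+-assoc (1ₛ s) (lower s) (new s))) ⟩
          (1ₛ +ₛ lower) +ₛ new           ≈⟨ +ₛ-congʳ new (generating-unfold t) ⟨
          generating t +ₛ new            ∎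
          where
          open Truncated m
          lower new : Series
          lower = ∑ₛ m (λ i → attach t i *ₛ generating (suc i))
          new = monomial (w c) c *ₛ generating c

      generating-candidates : ∀ t s → (∀ x → 1 ≤ x → x ≤ s → R t x) →
        generating t s ≡ ∑ₗ (λ xs → [ chain? s xs ]∙ weight xs) (candidates m)
      generating-candidates t s below = begin
        ∑ (suc m) (λ k → ∑ₗ (λ xs → chainSeries t xs s) (listsOfLength k m))
          ≡⟨ ∑-cong (suc m) (λ k _ → ∑ₗ-cong (listsOfLength k m) drop-bound) ⟩
        ∑ (suc m) (λ k → ∑ₗ f (listsOfLength k m))
          ≡⟨ ∑ₗ-applyUpTo (λ k → ∑ₗ f (listsOfLength k m)) (suc m) id ⟨
        ∑ₗ (λ k → ∑ₗ f (listsOfLength k m)) (upTo (suc m))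
          ≡⟨ ∑ₗ-concatMap f (λ k → listsOfLength k m) (upTo (suc m)) ⟨
        ∑ₗ f (candidates m) ∎
        where
        open ≡-Reasoning
        f : List ℕ → A
        f xs = [ chain? s xs ]∙ weight xs
        drop-bound : ∀ xs → chainSeries t xs s ≡ f xs
        drop-bound xs = []-⇔ (λ (lk , pos , Σ≡s) → Linked.tail lk , pos , Σ≡s)
                             (λ { (lk , pos , refl) → linked-below below pos lk , pos , refl })
                             (chainBelow? t s xs) _ (weight xs)

  module UnrestrictedParts (w : ℕ → A) where

    open WeightedChains {R = ℕ._≥_} (λ t x → x ≤? t) w public

    inverse-product : ∀ m T → T ≤ m → ∏ T (λ t → binomial (- w t) t) *ₛ generating m T ≈[ m ] 1ₛ
    inverse-product m zero    _      = ≈-trans (*ₛ-identityˡ _) (generating-trivial m 0 (λ _ ()))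
      where open Truncated m
    inverse-product m (suc T) 1+T≤m = begin
      (∏ T f *ₛ f (suc T)) *ₛ G (suc T)   ≈⟨ *ₛ-assocₜ (∏ T f) (f (suc T)) (G (suc T)) ⟩
      ∏ T f *ₛ (f (suc T) *ₛ G (suc T))   ≈⟨ *ₛ-congˡ (∏ T f) remove-part ⟩
      ∏ T f *ₛ G T                        ≈⟨ inverse-product m T (≤-trans (n≤1+n T) 1+T≤m) ⟩
      1ₛ                                  ∎
      where
      open Truncated m
      f = λ t → binomial (- w t) t
      G : ℕ → Series
      G = generating m
      new : Series
      new = monomial (w (suc T)) (suc T) *ₛ G (suc T)
      column : G (suc T) ≈ G T +ₛ new
      column = generating-column m {T} {suc T} {T}
        (λ y y≤1+T → Data.Sum.map ≤-pred id (m≤n⇒m<n∨m≡n y≤1+T))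
        (λ { y (inj₁ y≤T) → m≤n⇒m≤1+n y≤T ; y (inj₂ refl) → ≤-refl }) (1+n≰n) 1+T≤m
      remove-part : f (suc T) *ₛ G (suc T) ≈ G T
      remove-part = begin
        (1ₛ +ₛ monomial (- w (suc T)) (suc T)) *ₛ G (suc T)
          ≈⟨ solve 3 (λ o x g → (o ⊕ x) ⊗ g ⊜ (o ⊗ g ⊕ x ⊗ g)) ≈-refl
                     1ₛ (monomial (- w (suc T)) (suc T)) (G (suc T)) ⟩
        1ₛ *ₛ G (suc T) +ₛ monomial (- w (suc T)) (suc T) *ₛ G (suc T)
          ≈⟨ +ₛ-cong (≈-trans (*ₛ-identityˡ (G (suc T))) column)
                     (≗⇒≈ (monomial-neg-*ₛ (w (suc T)) (suc T) (G (suc T)))) ⟩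
        G T +ₛ new +ₛ -ₛ new
          ≈⟨ +ₛ-assoc (G T) new (-ₛ new) ⟩
        G T +ₛ (new +ₛ -ₛ new)
          ≈⟨ +ₛ-congˡ (G T) (+ₛ-inverseʳ new) ⟩
        G T +ₛ 0ₛ
          ≈⟨ +ₛ-identityʳ (G T) ⟩
        G T ∎

  module DistinctParts (w : ℕ → A) where

    open WeightedChains {R = ℕ._>_} (λ t x → suc x ≤? t) w public

    product : ∀ m T → T ≤ m → generating m (suc T) ≈[ m ] ∏ T (λ t → binomial (w t) t)
    product m zero    _      = generating-trivial m 1 (λ { _ (s≤s ()) })
    product m (suc T) 1+T≤m = begin
      G (suc (suc T))
        ≈⟨ column ⟩
      G (suc T) +ₛ x *ₛ G (suc T)
        ≈⟨ +ₛ-congʳ (x *ₛ G (suc T)) (*ₛ-identityˡ (G (suc T))) ⟨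
      1ₛ *ₛ G (suc T) +ₛ x *ₛ G (suc T)
        ≈⟨ solve 3 (λ o x g → o ⊗ g ⊕ x ⊗ g ⊜ g ⊗ (o ⊕ x)) ≈-refl 1ₛ x (G (suc T)) ⟩
      G (suc T) *ₛ f (suc T)
        ≈⟨ *ₛ-congʳ (f (suc T)) (product m T (≤-trans (n≤1+n T) 1+T≤m)) ⟩
      ∏ T f *ₛ f (suc T) ∎
      where
      open Truncated m
      f G : ℕ → Series
      f = λ t → binomial (w t) t
      G = generating m
      x : Series
      x = monomial (w (suc T)) (suc T)
      column : G (suc (suc T)) ≈ G (suc T) +ₛ x *ₛ G (suc T)
      column = generating-column m {suc T} {suc (suc T)} {T}
        (λ y 2+y≤2+T → m≤n⇒m<n∨m≡n (≤-pred 2+y≤2+T))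
        (λ { y (inj₁ 1+y≤1+T) → m≤n⇒m≤1+n 1+y≤1+T ; y (inj₂ refl) → ≤-refl }) (1+n≰n) 1+T≤m

    generating-stable : ∀ {m n} → m ≤ n → generating n (suc n) ≈[ m ] generating m (suc m)
    generating-stable {m} {n} m≤n = begin
      generating n (suc n)   ≈⟨ ≈-weaken m≤n (product n n ≤-refl) ⟩
      ∏ n f                  ≈⟨ ∏-trivial-tail n m f m≤n (λ t m<t _ → binomial-high (w t) t m<t) ⟩
      ∏ m f                  ≈⟨ product m m ≤-refl ⟨
      generating m (suc m)   ∎
      where
      open Truncated m
      f : ℕ → Series
      f = λ t → binomial (w t) t

  onEven : (ℕ → Series) → ℕ → Series
  onEven f t with even? t
  ... | yes _ = f t
  ... | no  _ = 1ₛ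

  module _ {N : ℕ} where
    open Truncated N

    ∏-onEven-double : ∀ n h → ∏ n (λ t → h (t ℕ.+ t)) ≈ ∏ (n ℕ.+ n) (onEven h)
    ∏-onEven-double zero    h = ≈-refl
    ∏-onEven-double (suc n) h = begin
      ∏ n (λ t → h (t ℕ.+ t)) *ₛ h (suc n ℕ.+ suc n)
        ≈⟨ *ₛ-congʳ (h (suc n ℕ.+ suc n)) (∏-onEven-double n h) ⟩
      ∏ (n ℕ.+ n) (onEven h) *ₛ h (suc n ℕ.+ suc n)
        ≡⟨ cong (λ k → ∏ (n ℕ.+ n) (onEven h) *ₛ h (suc k)) (ℕₚ.+-suc n n) ⟩
      ∏ (n ℕ.+ n) (onEven h) *ₛ h (2n+2)
        ≈⟨ *ₛ-cong (≈-sym (≈-trans (*ₛ-congˡ (∏ (n ℕ.+ n) (onEven h)) odd-factor)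
                                     (*ₛ-identityʳ (∏ (n ℕ.+ n) (onEven h)))))
                   even-factor ⟩
      ∏ (2n+2) (onEven h)
        ≡⟨ cong (λ k → ∏ (suc k) (onEven h)) (ℕₚ.+-suc n n) ⟨
      ∏ (suc n ℕ.+ suc n) (onEven h) ∎
      where
      2n+2 : ℕ
      2n+2 = suc (suc (n ℕ.+ n))
      odd-factor : onEven h (suc (n ℕ.+ n)) ≈ 1ₛ
      odd-factor with even? (suc (n ℕ.+ n))
      ... | yes even = ⊥-elim (odd-double n even)
      ... | no _     = ≈-refl
      even-factor : h 2n+2 ≈ onEven h 2n+2
      even-factor with even? 2n+2
      ... | yes _   = ≈-refl
      ... | no odd  = ⊥-elim (odd (subst Even (cong suc (ℕₚ.+-suc n n)) (even-double (suc n))))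

  module LogarithmicDerivative (ε : A) (ε*ε≡0 : ε * ε ≡ 0#) where

    u : A
    u = 1# + ε

    u*ε≡ε : u * ε ≡ ε
    u*ε≡ε = trans (distribʳ ε 1# ε) (trans (cong₂ _+_ (*-identityˡ ε) ε*ε≡0) (+-identityʳ ε))

    u*u≡u+ε : u * u ≡ u + ε
    u*u≡u+ε = trans (distribˡ u 1# ε) (cong₂ _+_ (*-identityʳ u) u*ε≡ε)

    -u*u+ε≡-u : - (u * u) + ε ≡ - u
    -u*u+ε≡-u = begin
      - (u * u) + ε         ≡⟨ cong (λ a → - a + ε) u*u≡u+ε ⟩
      - (u + ε) + ε         ≡⟨ cong (_+ ε) (-‿+-comm u ε) ⟨
      (- u + - ε) + ε       ≡⟨ +-assoc (- u) (- ε) ε ⟩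
      - u + (- ε + ε)       ≡⟨ cong (- u +_) (-‿inverseˡ ε) ⟩
      - u + 0#              ≡⟨ +-identityʳ (- u) ⟩
      - u                   ∎
      where open ≡-Reasoning

    ε-u*u*ε≡0 : ε + - (u * u) * ε ≡ 0#
    ε-u*u*ε≡0 = begin
      ε + - (u * u) * ε     ≡⟨ cong (ε +_) (-‿distribˡ-* (u * u) ε) ⟨
      ε + - (u * u * ε)     ≡⟨ cong (λ a → ε + - a) (trans (*-assoc u u ε) (trans (cong (u *_) u*ε≡ε) u*ε≡ε)) ⟩
      ε + - ε               ≡⟨ -‿inverseʳ ε ⟩
      0#                    ∎
      where open ≡-Reasoning

    -- qᵗ + q²ᵗ + … + qᴺᵗ, which is qᵗ / (1 − qᵗ) up to degree N.
    geometric : ℕ → ℕ → Series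
    geometric N t = ∑ₛ N (λ b → X (t ℕ.* suc b))

    geometric-shift : ∀ N t → X t +ₛ X t *ₛ geometric N t ≗ geometric (suc N) t
    geometric-shift N t s = sym (begin
      ∑ (suc N) (λ b → X (t ℕ.* suc b) s)
        ≡⟨ ∑-head N (λ b → X (t ℕ.* suc b) s) ⟩
      X (t ℕ.* 1) s + ∑ N (λ b → X (t ℕ.* suc (suc b)) s)
        ≡⟨ cong₂ _+_ (cong (λ k → X k s) (ℕₚ.*-identityʳ t))
                     (∑-cong N (λ b _ → trans (cong (λ k → X k s) (ℕₚ.*-suc t (suc b))) (sym (X-+ t _ s)))) ⟩
      X t s + ∑ N (λ b → (X t *ₛ X (t ℕ.* suc b)) s)
        ≡⟨ cong (X t s +_) (*ₛ-∑ₛ (X t) N (λ b → X (t ℕ.* suc b)) s) ⟨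
      X t s + (X t *ₛ geometric N t) s ∎)
      where open ≡-Reasoning

    evenGeometric : ℕ → Series
    evenGeometric N = ∑ₛ N (λ i → [ even? (suc i) ]∙ₛ geometric N (suc i))

    -- The factor by which the logarithmic derivative enters: 1 + ε ∑_{a even} qᵃ / (1 − qᵃ).
    correction : ℕ → Series
    correction N = 1ₛ +ₛ κ ε *ₛ evenGeometric N

    *ₛ-correction : ∀ N F s → (F *ₛ correction N) s ≡ F s + ε * (evenGeometric N *ₛ F) s
    *ₛ-correction N F s = begin
      (F *ₛ (1ₛ +ₛ κ ε *ₛ evenGeometric N)) s
        ≡⟨ *ₛ-distribˡ F 1ₛ (κ ε *ₛ evenGeometric N) s ⟩
      (F *ₛ 1ₛ) s + (F *ₛ (κ ε *ₛ evenGeometric N)) s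
        ≡⟨ cong₂ _+_ (trans (*ₛ-comm F 1ₛ s) (1ₛ-*ₛ F s))
                     (trans (*ₛ-comm F (κ ε *ₛ evenGeometric N) s)
                       (trans (*ₛ-assoc (κ ε) (evenGeometric N) F s) (κ-*ₛ ε (evenGeometric N *ₛ F) s))) ⟩
      F s + ε * (evenGeometric N *ₛ F) s ∎
      where open ≡-Reasoning

    evenGeometric-*ₛ : ∀ N F s → (evenGeometric N *ₛ F) s
      ≡ ∑ N (λ i → [ even? (suc i) ]∙ ∑ N (λ j → [ suc i ℕ.* suc j ≤? s ]∙ F (s ∸ suc i ℕ.* suc j)))
    evenGeometric-*ₛ N F s = begin
      (evenGeometric N *ₛ F) s
        ≡⟨ *ₛ-comm (evenGeometric N) F s ⟩
      (F *ₛ evenGeometric N) s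
        ≡⟨ *ₛ-∑ₛ F N (λ i → [ even? (suc i) ]∙ₛ geometric N (suc i)) s ⟩
      ∑ N (λ i → (F *ₛ [ even? (suc i) ]∙ₛ geometric N (suc i)) s)
        ≡⟨ ∑-cong N (λ i _ → trans (*ₛ-[]ₛ (even? (suc i)) F (geometric N (suc i)) s)
                                    (cong ([ even? (suc i) ]∙_) (trans (*ₛ-∑ₛ F N (λ j → X (suc i ℕ.* suc j)) s)
                                      (∑-cong N (λ j _ → trans (*ₛ-comm F (X (suc i ℕ.* suc j)) s) (X-*ₛ _ F s)))))) ⟩
      ∑ N (λ i → [ even? (suc i) ]∙ ∑ N (λ j → [ suc i ℕ.* suc j ≤? s ]∙ F (s ∸ suc i ℕ.* suc j))) ∎
      where open ≡-Reasoning

    module _ {N : ℕ} where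

      open Truncated N

      geometric-unfold : ∀ t → 1 ≤ t → geometric N t ≈ X t +ₛ X t *ₛ geometric N t
      geometric-unfold t 1≤t = ≈-sym (begin
        X t +ₛ X t *ₛ geometric N t        ≈⟨ ≗⇒≈ (geometric-shift N t) ⟩
        geometric N t +ₛ X (t ℕ.* suc N)   ≈⟨ +ₛ-congˡ (geometric N t) (X-big (t ℕ.* suc N) (beyond t 1≤t)) ⟩
        geometric N t +ₛ 0ₛ                ≈⟨ +ₛ-identityʳ (geometric N t) ⟩
        geometric N t                      ∎)
        where
        beyond : ∀ t → 1 ≤ t → N < t ℕ.* suc N
        beyond (suc t) _ = ℕₚ.m≤n*m (suc N) (suc t)

      κε*κε≈0 : κ ε *ₛ κ ε ≈ 0ₛ
      κε*κε≈0 = ≗⇒≈ (λ s → trans (κ-* ε ε s) (trans (cong (λ a → κ a s) ε*ε≡0) (monomial-0# 0 s)))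

      log-derivative-factor : ∀ t → 1 ≤ t → binomial (- (u * u)) t *ₛ (1ₛ +ₛ κ ε *ₛ geometric N t) ≈ binomial (- u) t
      log-derivative-factor t 1≤t = begin
        binomial (- (u * u)) t *ₛ (1ₛ +ₛ e *ₛ E)
          ≈⟨ *ₛ-congʳ (1ₛ +ₛ e *ₛ E) (+ₛ-congˡ 1ₛ (≗⇒≈ (monomial≗κ*X (- (u * u)) t))) ⟩
        (1ₛ +ₛ K *ₛ x) *ₛ (1ₛ +ₛ e *ₛ E)
          ≈⟨ 1+-*ₛ-1+ (K *ₛ x) (e *ₛ E) ⟩
        1ₛ +ₛ K *ₛ x +ₛ e *ₛ E +ₛ K *ₛ x *ₛ (e *ₛ E)
          ≈⟨ +ₛ-congʳ (K *ₛ x *ₛ (e *ₛ E)) (+ₛ-congˡ (1ₛ +ₛ K *ₛ x) (*ₛ-congˡ e (geometric-unfold t 1≤t))) ⟩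
        1ₛ +ₛ K *ₛ x +ₛ e *ₛ (x +ₛ x *ₛ E) +ₛ K *ₛ x *ₛ (e *ₛ E)
          ≈⟨ solve 5 (λ o k x e g → (o ⊕ k ⊗ x ⊕ e ⊗ (x ⊕ x ⊗ g) ⊕ k ⊗ x ⊗ (e ⊗ g))
                                    ⊜ (o ⊕ (k ⊕ e) ⊗ x ⊕ (e ⊕ k ⊗ e) ⊗ (x ⊗ g))) ≈-refl 1ₛ K x e E ⟩
        1ₛ +ₛ (K +ₛ e) *ₛ x +ₛ (e +ₛ K *ₛ e) *ₛ (x *ₛ E)
          ≈⟨ +ₛ-cong (+ₛ-congˡ 1ₛ (*ₛ-congʳ x linear)) (≈-trans (*ₛ-congʳ (x *ₛ E) quadratic) (*ₛ-zeroˡ (x *ₛ E))) ⟩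
        1ₛ +ₛ κ (- u) *ₛ x +ₛ 0ₛ
          ≈⟨ +ₛ-identityʳ _ ⟩
        1ₛ +ₛ κ (- u) *ₛ x
          ≈⟨ +ₛ-congˡ 1ₛ (≗⇒≈ (λ s → sym (monomial≗κ*X (- u) t s))) ⟩
        binomial (- u) t ∎
        where
        K e x E : Series
        K = κ (- (u * u))
        e = κ ε
        x = X t
        E = geometric N t
        linear : K +ₛ e ≈ κ (- u)
        linear = ≗⇒≈ (λ s → trans (κ-+ (- (u * u)) ε s) (cong (λ a → κ a s) -u*u+ε≡-u))
        quadratic : e +ₛ K *ₛ e ≈ 0ₛ
        quadratic = ≗⇒≈ (λ s → trans (cong (e s +_) (κ-* (- (u * u)) ε s))
                                 (trans (κ-+ ε _ s) (trans (cong (λ a → κ a s) ε-u*u*ε≡0) (monomial-0# 0 s))))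

      correction-as-product : ∀ n → ∏ n (onEven (λ t → 1ₛ +ₛ κ ε *ₛ geometric N t))
                                  ≈ 1ₛ +ₛ κ ε *ₛ ∑ₛ n (λ i → [ even? (suc i) ]∙ₛ geometric N (suc i))
      correction-as-product zero    = ≈-sym (≈-trans (+ₛ-congˡ 1ₛ (*ₛ-zeroʳ (κ ε))) (+ₛ-identityʳ 1ₛ))
      correction-as-product (suc n) = begin
        ∏ n (onEven (λ t → 1ₛ +ₛ e *ₛ geometric N t)) *ₛ onEven (λ t → 1ₛ +ₛ e *ₛ geometric N t) (suc n)
          ≈⟨ *ₛ-cong (correction-as-product n) last-factor ⟩
        (1ₛ +ₛ e *ₛ S) *ₛ (1ₛ +ₛ e *ₛ F)
          ≈⟨ 1+-*ₛ-1+ (e *ₛ S) (e *ₛ F) ⟩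
        1ₛ +ₛ e *ₛ S +ₛ e *ₛ F +ₛ e *ₛ S *ₛ (e *ₛ F)
          ≈⟨ solve 4 (λ o e s f → (o ⊕ e ⊗ s ⊕ e ⊗ f ⊕ e ⊗ s ⊗ (e ⊗ f)) ⊜ (o ⊕ e ⊗ (s ⊕ f) ⊕ (e ⊗ e) ⊗ (s ⊗ f)))
                   ≈-refl 1ₛ e S F ⟩
        1ₛ +ₛ e *ₛ (S +ₛ F) +ₛ (e *ₛ e) *ₛ (S *ₛ F)
          ≈⟨ +ₛ-congˡ (1ₛ +ₛ e *ₛ (S +ₛ F)) (≈-trans (*ₛ-congʳ (S *ₛ F) κε*κε≈0) (*ₛ-zeroˡ (S *ₛ F))) ⟩
        1ₛ +ₛ e *ₛ (S +ₛ F) +ₛ 0ₛ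
          ≈⟨ +ₛ-identityʳ _ ⟩
        1ₛ +ₛ e *ₛ ∑ₛ (suc n) (λ i → [ even? (suc i) ]∙ₛ geometric N (suc i)) ∎
        where
        e S F : Series
        e = κ ε
        S = ∑ₛ n (λ i → [ even? (suc i) ]∙ₛ geometric N (suc i))
        F = [ even? (suc n) ]∙ₛ geometric N (suc n)
        last-factor : onEven (λ t → 1ₛ +ₛ e *ₛ geometric N t) (suc n) ≈ 1ₛ +ₛ e *ₛ F
        last-factor with even? (suc n)
        ... | yes _ = ≈-refl
        ... | no  _ = ≈-sym (≈-trans (+ₛ-congˡ 1ₛ (*ₛ-zeroʳ e)) (+ₛ-identityʳ 1ₛ))

      module _ (P Q : ℕ → A)
               (even-part : ∀ t → Even t → (- P t + Q t ≡ u) × (- P t * Q t ≡ 0#))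
               (odd-part  : ∀ t → ¬ Even t → (- P t + Q t ≡ 0#) × (- P t * Q t ≡ - (u * u))) where

        paired-factor : ∀ t → binomial (- P t) t *ₛ binomial (Q t) t *ₛ onEven (binomial (- u)) t
                            ≈ binomial (- (u * u)) (t ℕ.+ t)
        paired-factor t with even? t
        ... | yes even = begin
          binomial (- P t) t *ₛ binomial (Q t) t *ₛ binomial (- u) t
            ≈⟨ *ₛ-congʳ (binomial (- u) t) (binomial-*ₛ (- P t) (Q t) t (proj₁ (even-part t even))
                                                                       (proj₂ (even-part t even))) ⟩
          (binomial u t +ₛ monomial 0# (t ℕ.+ t)) *ₛ binomial (- u) t
            ≈⟨ *ₛ-congʳ (binomial (- u) t) (+ₛ-monomial-0# (binomial u t) (t ℕ.+ t)) ⟩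
          binomial u t *ₛ binomial (- u) t
            ≈⟨ binomial-*ₛ u (- u) t (-‿inverseʳ u) (sym (-‿distribʳ-* u u)) ⟩
          1ₛ +ₛ monomial 0# t +ₛ monomial (- (u * u)) (t ℕ.+ t)
            ≈⟨ 1+monomial-0# t (monomial (- (u * u)) (t ℕ.+ t)) ⟩
          binomial (- (u * u)) (t ℕ.+ t) ∎
        ... | no odd = begin
          binomial (- P t) t *ₛ binomial (Q t) t *ₛ 1ₛ
            ≈⟨ *ₛ-identityʳ _ ⟩
          binomial (- P t) t *ₛ binomial (Q t) t
            ≈⟨ binomial-*ₛ (- P t) (Q t) t (proj₁ (odd-part t odd)) (proj₂ (odd-part t odd)) ⟩
          1ₛ +ₛ monomial 0# t +ₛ monomial (- (u * u)) (t ℕ.+ t)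
            ≈⟨ 1+monomial-0# t (monomial (- (u * u)) (t ℕ.+ t)) ⟩
          binomial (- (u * u)) (t ℕ.+ t) ∎

        -- Multiplying by H = ∏_{t even} (1 − u qᵗ) pairs each even factor 1 + u qᵗ into 1 − u² q²ᵗ;
        -- together with the odd factors this is ∏_t (1 − u² q²ᵗ) = ∏_{t even} (1 − u² qᵗ), and the
        -- correction turns each 1 − u² qᵗ back into 1 − u qᵗ.
        product-identity : ∏ N (λ t → binomial (- P t) t) *ₛ ∏ N (λ t → binomial (Q t) t) *ₛ correction N ≈ 1ₛ
        product-identity = cancel-unit N H H₀≡1 (begin
          H *ₛ (C *ₛ Q′ *ₛ correction N)
            ≈⟨ *ₛ-assocₜ H (C *ₛ Q′) (correction N) ⟨
          H *ₛ (C *ₛ Q′) *ₛ correction N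
            ≈⟨ *ₛ-congʳ (correction N) (*ₛ-commₜ H (C *ₛ Q′)) ⟩
          C *ₛ Q′ *ₛ H *ₛ correction N
            ≈⟨ *ₛ-cong paired correction-product ⟩
          ∏ N (onEven (binomial (- (u * u)))) *ₛ ∏ N (onEven (λ t → 1ₛ +ₛ κ ε *ₛ geometric N t))
            ≈⟨ ∏-*ₛ N _ _ ⟨
          ∏ N (λ t → onEven (binomial (- (u * u))) t *ₛ onEven (λ t → 1ₛ +ₛ κ ε *ₛ geometric N t) t)
            ≈⟨ ∏-cong N correction-factors ⟩
          H
            ≈⟨ *ₛ-identityʳ H ⟨
          H *ₛ 1ₛ ∎)
          where
          C Q′ H : Series
          C = ∏ N (λ t → binomial (- P t) t)
          Q′ = ∏ N (λ t → binomial (Q t) t)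
          H = ∏ N (onEven (binomial (- u)))
          H₀≡1 : H 0 ≡ 1#
          H₀≡1 = ∏-constant-term N (onEven (binomial (- u))) constant-term
            where
            constant-term : ∀ t → 1 ≤ t → onEven (binomial (- u)) t 0 ≡ 1#
            constant-term t 1≤t with even? t
            ... | yes _ = binomial-constant-term (- u) t 1≤t
            ... | no  _ = refl
          paired : C *ₛ Q′ *ₛ H ≈ ∏ N (onEven (binomial (- (u * u))))
          paired = begin
            C *ₛ Q′ *ₛ H
              ≈⟨ *ₛ-congʳ H (∏-*ₛ N _ _) ⟨
            ∏ N (λ t → binomial (- P t) t *ₛ binomial (Q t) t) *ₛ H
              ≈⟨ ∏-*ₛ N _ _ ⟨
            ∏ N (λ t → binomial (- P t) t *ₛ binomial (Q t) t *ₛ onEven (binomial (- u)) t)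
              ≈⟨ ∏-cong N (λ t _ _ → paired-factor t) ⟩
            ∏ N (λ t → binomial (- (u * u)) (t ℕ.+ t))
              ≈⟨ ∏-onEven-double N (binomial (- (u * u))) ⟩
            ∏ (N ℕ.+ N) (onEven (binomial (- (u * u))))
              ≈⟨ ∏-trivial-tail (N ℕ.+ N) N _ (m≤m+n N N) high ⟩
            ∏ N (onEven (binomial (- (u * u)))) ∎
            where
            high : ∀ t → N < t → t ≤ N ℕ.+ N → onEven (binomial (- (u * u))) t ≈ 1ₛ
            high t N<t _ with even? t
            ... | yes _ = binomial-high (- (u * u)) t N<t
            ... | no  _ = ≈-refl
          correction-product : correction N ≈ ∏ N (onEven (λ t → 1ₛ +ₛ κ ε *ₛ geometric N t))
          correction-product = ≈-sym (correction-as-product N)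
          correction-factors : ∀ t → 1 ≤ t → t ≤ N →
            onEven (binomial (- (u * u))) t *ₛ onEven (λ t → 1ₛ +ₛ κ ε *ₛ geometric N t) t ≈ onEven (binomial (- u)) t
          correction-factors t 1≤t _ with even? t
          ... | yes _ = log-derivative-factor t 1≤t
          ... | no  _ = *ₛ-identityˡ 1ₛ

module DualNumbers where

  open import Data.Integer as Int using (ℤ; +_)
  import Data.Integer.Properties as ℤₚ
  open import Data.Integer.Tactic.RingSolver using (solve-∀)
  open import Data.Product using (_,_)
  open import Relation.Binary.PropositionalEquality

  infixl 6 _+ᴰ_
  infixl 7 _*ᴰ_
  infix  8 -ᴰ_
  infix  5 _+ε_

  record 𝔻 : Set where
    constructor _+ε_
    field
      re εpart : ℤ
  open 𝔻 public

  _+ᴰ_ _*ᴰ_ : 𝔻 → 𝔻 → 𝔻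
  (a +ε b) +ᴰ (c +ε d) = a Int.+ c +ε b Int.+ d
  (a +ε b) *ᴰ (c +ε d) = a Int.* c +ε a Int.* d Int.+ b Int.* c

  -ᴰ_ : 𝔻 → 𝔻
  -ᴰ (a +ε b) = Int.- a +ε Int.- b

  0ᴰ 1ᴰ ε : 𝔻
  0ᴰ = + 0 +ε + 0
  1ᴰ = + 1 +ε + 0
  ε  = + 0 +ε + 1

  isCommutativeRing : IsCommutativeRing _≡_ _+ᴰ_ _*ᴰ_ -ᴰ_ 0ᴰ 1ᴰ
  isCommutativeRing = record
    { isRing = record
      { +-isAbelianGroup = record
        { isGroup = record
          { isMonoid = record
            { isSemigroup = record
              { isMagma = record { isEquivalence = isEquivalence ; ∙-cong = cong₂ _+ᴰ_ }
              ; assoc = λ { (a +ε b) (c +ε d) (e +ε f) → cong₂ _+ε_ (ℤₚ.+-assoc a c e) (ℤₚ.+-assoc b d f) } }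
            ; identity = (λ { (a +ε b) → cong₂ _+ε_ (ℤₚ.+-identityˡ a) (ℤₚ.+-identityˡ b) })
                       , (λ { (a +ε b) → cong₂ _+ε_ (ℤₚ.+-identityʳ a) (ℤₚ.+-identityʳ b) }) }
          ; inverse = (λ { (a +ε b) → cong₂ _+ε_ (ℤₚ.+-inverseˡ a) (ℤₚ.+-inverseˡ b) })
                    , (λ { (a +ε b) → cong₂ _+ε_ (ℤₚ.+-inverseʳ a) (ℤₚ.+-inverseʳ b) })
          ; ⁻¹-cong = cong -ᴰ_ }
        ; comm = λ { (a +ε b) (c +ε d) → cong₂ _+ε_ (ℤₚ.+-comm a c) (ℤₚ.+-comm b d) } }
      ; *-cong = cong₂ _*ᴰ_
      ; *-assoc = λ { (a +ε b) (c +ε d) (e +ε f) → cong₂ _+ε_ (ℤₚ.*-assoc a c e) (assoc-ε a b c d e f) }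
      ; *-identity = (λ { (a +ε b) → cong₂ _+ε_ (ℤₚ.*-identityˡ a) (identityˡ-ε a b) })
                   , (λ { (a +ε b) → cong₂ _+ε_ (ℤₚ.*-identityʳ a) (identityʳ-ε a b) })
      ; distrib = (λ { (a +ε b) (c +ε d) (e +ε f) → cong₂ _+ε_ (ℤₚ.*-distribˡ-+ a c e) (distribˡ-ε a b c d e f) })
                , (λ { (a +ε b) (c +ε d) (e +ε f) → cong₂ _+ε_ (ℤₚ.*-distribʳ-+ a c e) (distribʳ-ε a b c d e f) }) }
    ; *-comm = λ { (a +ε b) (c +ε d) → cong₂ _+ε_ (ℤₚ.*-comm a c) (comm-ε a b c d) } }
    where
    open Int using (_+_; _*_)
    assoc-ε : ∀ a b c d e f → (a * c) * f + (a * d + b * c) * e ≡ a * (c * f + d * e) + b * (c * e)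
    assoc-ε = solve-∀
    identityˡ-ε : ∀ a b → + 1 * b + + 0 * a ≡ b
    identityˡ-ε = solve-∀
    identityʳ-ε : ∀ a b → a * + 0 + b * + 1 ≡ b
    identityʳ-ε = solve-∀
    distribˡ-ε : ∀ a b c d e f → a * (d + f) + b * (c + e) ≡ (a * d + b * c) + (a * f + b * e)
    distribˡ-ε = solve-∀
    distribʳ-ε : ∀ a b c d e f → (c + e) * b + (d + f) * a ≡ (c * b + d * a) + (e * b + f * a)
    distribʳ-ε = solve-∀
    comm-ε : ∀ a b c d → a * d + b * c ≡ c * b + d * a
    comm-ε = solve-∀

module Counting where

  open DualNumbers
  open PowerSeries isCommutativeRing
  open Parity
  open import Data.Nat as ℕ using (ℕ; zero; suc; _∸_; _≤_; _<_; s≤s; _≤?_)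
  open import Data.Nat.Properties using (≤-refl; m≤n⇒m≤1+n; m∸n≤m)
  open import Data.Nat.ListAction using (sum)
  open import Data.Integer as Int using (ℤ; +_; _-_)
  import Data.Integer.Properties as ℤₚ
  open import Data.Integer.Tactic.RingSolver using (solve-∀)
  open import Data.List using (List; []; _∷_; map; filter; length; concatMap)
  open import Data.List.Properties using (filter-accept; filter-reject)
  open import Data.List.Relation.Unary.All using (All; all?; []; _∷_)
  open import Data.Product using (_×_; _,_; proj₁; proj₂)
  open import Data.Empty using (⊥-elim)
  open import Function using (_∘_)
  open import Relation.Nullary using (Dec; yes; no; ¬_)
  open import Relation.Nullary.Decidable using (_×-dec_; ¬?; _→-dec_)
  open import Relation.Binary.PropositionalEquality
  open import Data.Sum using ([_,_]′)
  open import Algebra.Bundles using (CommutativeRing)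
  open import Algebra.Properties.Ring (CommutativeRing.ring coefficientRing) using (-‿distribˡ-*; -‿distribʳ-*; -‿involutive)
  open CommutativeRing coefficientRing
    using () renaming (zeroˡ to zeroˡ-𝔻; +-identityˡ to +-identityˡ-𝔻; +-identityʳ to +-identityʳ-𝔻)

  -- (1 + ε)ˡ
  one : ℕ → 𝔻
  one ℓ = + 1 +ε + ℓ

  ι : ℤ → 𝔻
  ι a = a +ε + 0

  ∑ₗ-[]∙one : ∀ {B : Set} {P : B → Set} (d : ∀ x → Dec (P x)) (g : B → ℕ) xs →
    ∑ₗ (λ x → [ d x ]∙ one (g x)) xs ≡ + length (filter d xs) +ε + sum (map g (filter d xs))
  ∑ₗ-[]∙one d g []       = refl
  ∑ₗ-[]∙one d g (x ∷ xs) with d x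
  ... | yes _ = cong₂ _+ε_
    (trans (cong (Int._+_ (+ 1)) (cong re (∑ₗ-[]∙one d g xs))) (sym (ℤₚ.pos-+ 1 _)))
    (trans (cong (Int._+_ (+ g x)) (cong εpart (∑ₗ-[]∙one d g xs))) (sym (ℤₚ.pos-+ (g x) _)))
  ... | no  _ = cong₂ _+ε_
    (trans (ℤₚ.+-identityˡ _) (cong re (∑ₗ-[]∙one d g xs)))
    (trans (ℤₚ.+-identityˡ _) (cong εpart (∑ₗ-[]∙one d g xs)))

  ∑ₗ-[]∙ι : ∀ {B : Set} {P : B → Set} (d : ∀ x → Dec (P x)) (g : B → ℕ) xs →
    ∑ₗ (λ x → [ d x ]∙ ι (+ g x)) xs ≡ ι (+ sum (map g (filter d xs)))
  ∑ₗ-[]∙ι d g []       = refl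
  ∑ₗ-[]∙ι d g (x ∷ xs) with d x
  ... | yes _ = cong₂ _+ε_
    (trans (cong (Int._+_ (+ g x)) (cong re (∑ₗ-[]∙ι d g xs))) (sym (ℤₚ.pos-+ (g x) _)))
    (trans (ℤₚ.+-identityˡ _) (cong εpart (∑ₗ-[]∙ι d g xs)))
  ... | no  _ = cong₂ _+ε_
    (trans (ℤₚ.+-identityˡ _) (cong re (∑ₗ-[]∙ι d g xs)))
    (trans (ℤₚ.+-identityˡ _) (cong εpart (∑ₗ-[]∙ι d g xs)))

  open LogarithmicDerivative ε refl using (u; correction; evenGeometric; *ₛ-correction; evenGeometric-*ₛ; product-identity)

  signed : {P : Set} → Dec P → 𝔻 → 𝔻
  signed (yes _) v = v
  signed (no  _) v = -ᴰ v

  u*one : ∀ ℓ → u *ᴰ one ℓ ≡ one (suc ℓ)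
  u*one ℓ = cong (+ 1 +ε_) (trans (shift (+ ℓ)) (sym (ℤₚ.pos-+ 1 ℓ)))
    where
    shift : ∀ a → + 1 Int.* a Int.+ + 1 Int.* + 1 ≡ + 1 Int.+ a
    shift = solve-∀

  u*signed : ∀ {P : Set} (p : Dec P) v → u *ᴰ signed p v ≡ signed p (u *ᴰ v)
  u*signed (yes _) v = refl
  u*signed (no  _) v = sym (-‿distribʳ-* u v)

  -u*signed : ∀ k v → (-ᴰ u) *ᴰ signed (even? k) v ≡ signed (even? (suc k)) (u *ᴰ v)
  -u*signed k v with even? k | even? (suc k)
  ... | yes even | yes even′ = ⊥-elim (not-even-and-next-even k even even′)
  ... | yes _    | no _      = sym (-‿distribˡ-* u v)
  ... | no _     | yes _     =
    trans (sym (-‿distribˡ-* u (-ᴰ v))) (trans (cong -ᴰ_ (sym (-‿distribʳ-* u v))) (-‿involutive (u *ᴰ v)))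
  ... | no odd   | no odd′   = ⊥-elim ([ odd , odd′ ]′ (even-or-next-even k))

  signed-split : ∀ {P C : Set} (p : Dec P) (c : Dec C) v →
    [ p ×-dec c ]∙ v +ᴰ -ᴰ [ p ×-dec ¬? c ]∙ v ≡ [ p ]∙ signed c v
  signed-split (yes _) (yes _) v = +-identityʳ-𝔻 v
  signed-split (yes _) (no _)  v = +-identityˡ-𝔻 (-ᴰ v)
  signed-split (no _)  (yes _) v = refl
  signed-split (no _)  (no _)  v = refl

  re-∑-cong : ∀ n {f g : ℕ → 𝔻} → (∀ i → i < n → re (f i) ≡ re (g i)) → re (∑ n f) ≡ re (∑ n g)
  re-∑-cong zero    _    = refl
  re-∑-cong (suc n) f≡g = cong₂ Int._+_ (re-∑-cong n (λ i i<n → f≡g i (m≤n⇒m≤1+n i<n))) (f≡g n ≤-refl)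

  re-[]-cong : ∀ {P : Set} (p : Dec P) {a b : 𝔻} → (P → re a ≡ re b) → re ([ p ]∙ a) ≡ re ([ p ]∙ b)
  re-[]-cong (yes pr) a≡b = a≡b pr
  re-[]-cong (no _)   _   = refl

  εpart-ε* : ∀ z → εpart (ε *ᴰ z) ≡ re z
  εpart-ε* (a +ε b) = simplify a b
    where
    simplify : ∀ a b → + 0 Int.* b Int.+ + 1 Int.* a ≡ a
    simplify = solve-∀

  module ForResidues (r : ℕ) (L : List ℕ) where

    -- The weight of a part x in the signed series of P and in the series of Q, at z = u = 1 + ε.
    wP : ℕ → 𝔻
    wP x with even? x | congL? r L x
    ... | yes _ | yes _ = -ᴰ u
    ... | yes _ | no  _ = 0ᴰ
    ... | no  _ | _     = u

    wQ : ℕ → 𝔻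
    wQ x with even? x | congL? r L x
    ... | yes _ | yes _ = 0ᴰ
    ... | yes _ | no  _ = u
    ... | no  _ | _     = u

    wP-in : ∀ {x} → Even x → CongL r L x → wP x ≡ -ᴰ u
    wP-in {x} even inL with even? x | congL? r L x
    ... | yes _ | yes _    = refl
    ... | yes _ | no ¬inL  = ⊥-elim (¬inL inL)
    ... | no odd | _       = ⊥-elim (odd even)

    wP-out : ∀ {x} → Even x → ¬ CongL r L x → wP x ≡ 0ᴰ
    wP-out {x} even ¬inL with even? x | congL? r L x
    ... | yes _ | yes inL  = ⊥-elim (¬inL inL)
    ... | yes _ | no _     = refl
    ... | no odd | _       = ⊥-elim (odd even)

    wP-odd : ∀ {x} → ¬ Even x → wP x ≡ u
    wP-odd {x} odd with even? x
    ... | yes even = ⊥-elim (odd even)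
    ... | no _     = refl

    wQ-in : ∀ {x} → Even x × CongL r L x → wQ x ≡ 0ᴰ
    wQ-in {x} (even , inL) with even? x | congL? r L x
    ... | yes _ | yes _    = refl
    ... | yes _ | no ¬inL  = ⊥-elim (¬inL inL)
    ... | no odd | _       = ⊥-elim (odd even)

    wQ-out : ∀ {x} → ¬ (Even x × CongL r L x) → wQ x ≡ u
    wQ-out {x} ¬in with even? x | congL? r L x
    ... | yes even | yes inL = ⊥-elim (¬in (even , inL))
    ... | yes _    | no _    = refl
    ... | no _     | _       = refl

    EvenPartsInL NoEvenPartInL : List ℕ → Set
    EvenPartsInL  = All (λ x → Even x → CongL r L x)
    NoEvenPartInL = All (λ x → ¬ (Even x × CongL r L x))

    evenPartsInL? : ∀ xs → Dec (EvenPartsInL xs)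
    evenPartsInL? = all? (λ x → even? x →-dec congL? r L x)

    noEvenPartInL? : ∀ xs → Dec (NoEvenPartInL xs)
    noEvenPartInL? = all? (λ x → ¬? (even? x ×-dec congL? r L x))

    module P = UnrestrictedParts wP
    module Q = DistinctParts wQ

    weightP : ∀ xs → P.weight xs ≡ [ evenPartsInL? xs ]∙ signed (even? (numEven xs)) (one (length xs))
    weightP []       = refl
    weightP (x ∷ xs) = by-cases (even? x) (congL? r L x)
      where
      ℓ k : ℕ
      ℓ = length xs
      k = numEven xs
      drop-head : (Even x → CongL r L x) → ∀ v → [ evenPartsInL? xs ]∙ v ≡ [ evenPartsInL? (x ∷ xs) ]∙ v
      drop-head ok = []-⇔ (ok ∷_) (λ { (_ ∷ rest) → rest }) (evenPartsInL? xs) (evenPartsInL? (x ∷ xs))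
      by-cases : Dec (Even x) → Dec (CongL r L x) →
        wP x *ᴰ P.weight xs ≡ [ evenPartsInL? (x ∷ xs) ]∙ signed (even? (numEven (x ∷ xs))) (one (suc ℓ))
      by-cases (yes even) (yes inL) = begin
        wP x *ᴰ P.weight xs
          ≡⟨ cong₂ _*ᴰ_ (wP-in even inL) (weightP xs) ⟩
        (-ᴰ u) *ᴰ [ evenPartsInL? xs ]∙ signed (even? k) (one ℓ)
          ≡⟨ *-[] (evenPartsInL? xs) (-ᴰ u) _ ⟩
        [ evenPartsInL? xs ]∙ ((-ᴰ u) *ᴰ signed (even? k) (one ℓ))
          ≡⟨ cong ([ evenPartsInL? xs ]∙_) (trans (-u*signed k (one ℓ)) (cong (signed (even? (suc k))) (u*one ℓ))) ⟩
        [ evenPartsInL? xs ]∙ signed (even? (suc k)) (one (suc ℓ))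
          ≡⟨ drop-head (λ _ → inL) _ ⟩
        [ evenPartsInL? (x ∷ xs) ]∙ signed (even? (suc k)) (one (suc ℓ))
          ≡⟨ cong (λ j → [ evenPartsInL? (x ∷ xs) ]∙ signed (even? j) (one (suc ℓ)))
                  (cong length (filter-accept even? even)) ⟨
        [ evenPartsInL? (x ∷ xs) ]∙ signed (even? (numEven (x ∷ xs))) (one (suc ℓ)) ∎
        where open ≡-Reasoning
      by-cases (yes even) (no ¬inL) = begin
        wP x *ᴰ P.weight xs     ≡⟨ cong (_*ᴰ P.weight xs) (wP-out even ¬inL) ⟩
        0ᴰ *ᴰ P.weight xs       ≡⟨ zeroˡ-𝔻 (P.weight xs) ⟩
        0ᴰ                      ≡⟨ []-no (evenPartsInL? (x ∷ xs)) (λ { (ok ∷ _) → ¬inL (ok even) }) _ ⟨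
        [ evenPartsInL? (x ∷ xs) ]∙ signed (even? (numEven (x ∷ xs))) (one (suc ℓ)) ∎
        where open ≡-Reasoning
      by-cases (no odd) _ = begin
        wP x *ᴰ P.weight xs
          ≡⟨ cong₂ _*ᴰ_ (wP-odd odd) (weightP xs) ⟩
        u *ᴰ [ evenPartsInL? xs ]∙ signed (even? k) (one ℓ)
          ≡⟨ *-[] (evenPartsInL? xs) u _ ⟩
        [ evenPartsInL? xs ]∙ (u *ᴰ signed (even? k) (one ℓ))
          ≡⟨ cong ([ evenPartsInL? xs ]∙_) (trans (u*signed (even? k) (one ℓ)) (cong (signed (even? k)) (u*one ℓ))) ⟩
        [ evenPartsInL? xs ]∙ signed (even? k) (one (suc ℓ))
          ≡⟨ drop-head (λ even → ⊥-elim (odd even)) _ ⟩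
        [ evenPartsInL? (x ∷ xs) ]∙ signed (even? k) (one (suc ℓ))
          ≡⟨ cong (λ j → [ evenPartsInL? (x ∷ xs) ]∙ signed (even? j) (one (suc ℓ)))
                  (cong length (filter-reject even? odd)) ⟨
        [ evenPartsInL? (x ∷ xs) ]∙ signed (even? (numEven (x ∷ xs))) (one (suc ℓ)) ∎
        where open ≡-Reasoning

    weightQ : ∀ xs → Q.weight xs ≡ [ noEvenPartInL? xs ]∙ one (length xs)
    weightQ []       = refl
    weightQ (x ∷ xs) = by-cases (even? x ×-dec congL? r L x)
      where
      ℓ : ℕ
      ℓ = length xs
      by-cases : Dec (Even x × CongL r L x) → wQ x *ᴰ Q.weight xs ≡ [ noEvenPartInL? (x ∷ xs) ]∙ one (suc ℓ)
      by-cases (yes in-L) = begin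
        wQ x *ᴰ Q.weight xs     ≡⟨ cong (_*ᴰ Q.weight xs) (wQ-in in-L) ⟩
        0ᴰ *ᴰ Q.weight xs       ≡⟨ zeroˡ-𝔻 (Q.weight xs) ⟩
        0ᴰ                      ≡⟨ []-no (noEvenPartInL? (x ∷ xs)) (λ { (¬in ∷ _) → ¬in in-L }) _ ⟨
        [ noEvenPartInL? (x ∷ xs) ]∙ one (suc ℓ) ∎
        where open ≡-Reasoning
      by-cases (no ¬in-L) = begin
        wQ x *ᴰ Q.weight xs
          ≡⟨ cong₂ _*ᴰ_ (wQ-out ¬in-L) (weightQ xs) ⟩
        u *ᴰ [ noEvenPartInL? xs ]∙ one ℓ
          ≡⟨ *-[] (noEvenPartInL? xs) u _ ⟩
        [ noEvenPartInL? xs ]∙ (u *ᴰ one ℓ)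
          ≡⟨ cong ([ noEvenPartInL? xs ]∙_) (u*one ℓ) ⟩
        [ noEvenPartInL? xs ]∙ one (suc ℓ)
          ≡⟨ []-⇔ (¬in-L ∷_) (λ { (_ ∷ rest) → rest }) (noEvenPartInL? xs) (noEvenPartInL? (x ∷ xs)) _ ⟩
        [ noEvenPartInL? (x ∷ xs) ]∙ one (suc ℓ) ∎
        where open ≡-Reasoning

    coefficientP : ∀ n → P.generating n n n
      ≡ ∑ₗ (λ xs → [ inPe? r L n xs ]∙ one (length xs) +ᴰ -ᴰ [ inPo? r L n xs ]∙ one (length xs)) (candidates n)
    coefficientP n = trans (P.generating-candidates n n n (λ _ _ x≤n → x≤n)) (∑ₗ-cong (candidates n) signs)
      where
      signs : ∀ xs → [ isPartition? n xs ]∙ P.weight xs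
                   ≡ [ inPe? r L n xs ]∙ one (length xs) +ᴰ -ᴰ [ inPo? r L n xs ]∙ one (length xs)
      signs xs = begin
        [ isPartition? n xs ]∙ P.weight xs
          ≡⟨ cong ([ isPartition? n xs ]∙_) (weightP xs) ⟩
        [ isPartition? n xs ]∙ [ evenPartsInL? xs ]∙ signed (even? (numEven xs)) (one (length xs))
          ≡⟨ []-×-dec (isPartition? n xs) (evenPartsInL? xs) _ ⟩
        [ inP? r L n xs ]∙ signed (even? (numEven xs)) (one (length xs))
          ≡⟨ signed-split (inP? r L n xs) (even? (numEven xs)) (one (length xs)) ⟨
        [ inPe? r L n xs ]∙ one (length xs) +ᴰ -ᴰ [ inPo? r L n xs ]∙ one (length xs) ∎
        where open ≡-Reasoning

    coefficientQ : ∀ m → Q.generating m (suc m) m ≡ + length (Q r L m) +ε + sumLengths (Q r L m)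
    coefficientQ m = begin
      Q.generating m (suc m) m
        ≡⟨ Q.generating-candidates m (suc m) m (λ _ _ x≤m → s≤s x≤m) ⟩
      ∑ₗ (λ xs → [ isDistinctPartition? m xs ]∙ Q.weight xs) (candidates m)
        ≡⟨ ∑ₗ-cong (candidates m) (λ xs → trans (cong ([ isDistinctPartition? m xs ]∙_) (weightQ xs))
                                                ([]-×-dec (isDistinctPartition? m xs) (noEvenPartInL? xs) _)) ⟩
      ∑ₗ (λ xs → [ inQ? r L m xs ]∙ one (length xs)) (candidates m)
        ≡⟨ ∑ₗ-[]∙one (inQ? r L m) length (candidates m) ⟩
      + length (Q r L m) +ε + sumLengths (Q r L m) ∎
      where open ≡-Reasoning

    even-part : ∀ t → Even t → (-ᴰ wP t +ᴰ wQ t ≡ u) × (-ᴰ wP t *ᴰ wQ t ≡ 0ᴰ)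
    even-part t even with even? t | congL? r L t
    ... | yes _ | yes _ = refl , refl
    ... | yes _ | no  _ = refl , refl
    ... | no odd | _    = ⊥-elim (odd even)

    odd-part : ∀ t → ¬ Even t → (-ᴰ wP t +ᴰ wQ t ≡ 0ᴰ) × (-ᴰ wP t *ᴰ wQ t ≡ -ᴰ (u *ᴰ u))
    odd-part t odd with even? t
    ... | yes even = ⊥-elim (odd even)
    ... | no  _    = refl , refl

    series-identity : ∀ n → P.generating n n ≈[ n ] Q.generating n (suc n) *ₛ correction n
    series-identity n = cancel-unit n C C₀≡1 (begin
      C *ₛ P.generating n n             ≈⟨ P.inverse-product n n ≤-refl ⟩
      1ₛ                                ≈⟨ product-identity wP wQ even-part odd-part ⟨
      C *ₛ Q′ *ₛ correction n           ≈⟨ *ₛ-assocₜ C Q′ (correction n) ⟩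
      C *ₛ (Q′ *ₛ correction n)         ≈⟨ *ₛ-congˡ C (*ₛ-congʳ (correction n) (Q.product n n ≤-refl)) ⟨
      C *ₛ (Q.generating n (suc n) *ₛ correction n) ∎)
      where
      open Truncated n
      C Q′ : Series
      C = ∏ n (λ t → binomial (-ᴰ wP t) t)
      Q′ = ∏ n (λ t → binomial (wQ t) t)
      C₀≡1 : C 0 ≡ 1ᴰ
      C₀≡1 = ∏-constant-term n _ (λ t 1≤t → binomial-constant-term (-ᴰ wP t) t 1≤t)

    pairs-as-sum : ∀ n → ι (+ pairCount r L n)
      ≡ ∑ n (λ i → [ even? (suc i) ]∙ ∑ n (λ j → [ suc i ℕ.* suc j ≤? n ]∙ ι (+ length (Q r L (n ∸ suc i ℕ.* suc j)))))
    pairs-as-sum n = begin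
      ι (+ pairCount r L n)
        ≡⟨ ∑ₗ-[]∙ι admissible size pairs ⟨
      ∑ₗ f pairs
        ≡⟨ ∑ₗ-concatMap f (λ a → map (a ,_) (oneTo n)) (oneTo n) ⟩
      ∑ₗ (λ a → ∑ₗ f (map (a ,_) (oneTo n))) (oneTo n)
        ≡⟨ ∑ₗ-oneTo _ n ⟩
      ∑ n (λ i → ∑ₗ f (map (suc i ,_) (oneTo n)))
        ≡⟨ ∑-cong n (λ i _ → row i) ⟩
      ∑ n (λ i → [ even? (suc i) ]∙ ∑ n (λ j → [ suc i ℕ.* suc j ≤? n ]∙ ι (+ length (Q r L (n ∸ suc i ℕ.* suc j))))) ∎
      where
      open ≡-Reasoning
      pairs : List (ℕ × ℕ)
      pairs = concatMap (λ a → map (a ,_) (oneTo n)) (oneTo n)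
      admissible : ∀ (p : ℕ × ℕ) → Dec (Even (proj₁ p) × proj₁ p ℕ.* proj₂ p ≤ n)
      admissible p = even? (proj₁ p) ×-dec (proj₁ p ℕ.* proj₂ p ≤? n)
      size : ℕ × ℕ → ℕ
      size p = length (Q r L (n ∸ proj₁ p ℕ.* proj₂ p))
      f : ℕ × ℕ → 𝔻
      f p = [ admissible p ]∙ ι (+ size p)
      row : ∀ i → ∑ₗ f (map (suc i ,_) (oneTo n))
                ≡ [ even? (suc i) ]∙ ∑ n (λ j → [ suc i ℕ.* suc j ≤? n ]∙ ι (+ size (suc i , suc j)))
      row i = begin
        ∑ₗ f (map (suc i ,_) (oneTo n))
          ≡⟨ trans (∑ₗ-map f (suc i ,_) (oneTo n)) (∑ₗ-oneTo (f ∘ (suc i ,_)) n) ⟩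
        ∑ n (λ j → f (suc i , suc j))
          ≡⟨ ∑-cong n (λ j _ → sym ([]-×-dec (even? (suc i)) (suc i ℕ.* suc j ≤? n) _)) ⟩
        ∑ n (λ j → [ even? (suc i) ]∙ [ suc i ℕ.* suc j ≤? n ]∙ ι (+ size (suc i , suc j)))
          ≡⟨ ∑-[] (even? (suc i)) n _ ⟩
        [ even? (suc i) ]∙ ∑ n (λ j → [ suc i ℕ.* suc j ≤? n ]∙ ι (+ size (suc i , suc j))) ∎

    length-identity : ∀ n → + sumLengths (Pe r L n) - + sumLengths (Po r L n)
                          ≡ + sumLengths (Q r L n) Int.+ + pairCount r L n
    length-identity n = begin
      + sumLengths (Pe r L n) - + sumLengths (Po r L n)
        ≡⟨ cong₂ (λ a b → εpart a - εpart b) (∑ₗ-[]∙one (inPe? r L n) length (candidates n))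
                                              (∑ₗ-[]∙one (inPo? r L n) length (candidates n)) ⟨
      εpart (∑ₗ (λ xs → [ inPe? r L n xs ]∙ one (length xs)) (candidates n)
             +ᴰ -ᴰ ∑ₗ (λ xs → [ inPo? r L n xs ]∙ one (length xs)) (candidates n))
        ≡⟨ cong εpart (trans (coefficientP n) (∑ₗ-+- (λ xs → [ inPe? r L n xs ]∙ one (length xs))
                                                    (λ xs → [ inPo? r L n xs ]∙ one (length xs)) (candidates n))) ⟨
      εpart (P.generating n n n)
        ≡⟨ cong εpart (coefficient (series-identity n) n ≤-refl) ⟩
      εpart ((GQ *ₛ correction n) n)
        ≡⟨ cong εpart (*ₛ-correction n GQ n) ⟩
      εpart (GQ n) Int.+ εpart (ε *ᴰ (evenGeometric n *ₛ GQ) n)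
        ≡⟨ cong₂ Int._+_ (cong εpart (coefficientQ n)) (εpart-ε* ((evenGeometric n *ₛ GQ) n)) ⟩
      + sumLengths (Q r L n) Int.+ re ((evenGeometric n *ₛ GQ) n)
        ≡⟨ cong (Int._+_ (+ sumLengths (Q r L n))) pairs ⟩
      + sumLengths (Q r L n) Int.+ + pairCount r L n ∎
      where
      open ≡-Reasoning
      GQ : Series
      GQ = Q.generating n (suc n)
      pairs : re ((evenGeometric n *ₛ GQ) n) ≡ + pairCount r L n
      pairs = begin
        re ((evenGeometric n *ₛ GQ) n)
          ≡⟨ cong re (evenGeometric-*ₛ n GQ n) ⟩
        re (∑ n (λ i → [ even? (suc i) ]∙ ∑ n (λ j → [ suc i ℕ.* suc j ≤? n ]∙ GQ (n ∸ suc i ℕ.* suc j))))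
          ≡⟨ re-∑-cong n (λ i _ → re-[]-cong (even? (suc i)) (λ _ → re-∑-cong n (λ j _ →
               re-[]-cong (suc i ℕ.* suc j ≤? n) (λ _ → distinct-count (n ∸ suc i ℕ.* suc j) (m∸n≤m n (suc i ℕ.* suc j)))))) ⟩
        re (∑ n (λ i → [ even? (suc i) ]∙ ∑ n (λ j → [ suc i ℕ.* suc j ≤? n ]∙ ι (+ length (Q r L (n ∸ suc i ℕ.* suc j))))))
          ≡⟨ cong re (pairs-as-sum n) ⟨
        + pairCount r L n ∎
        where
        distinct-count : ∀ m → m ≤ n → re (GQ m) ≡ + length (Q r L m)
        distinct-count m m≤n = cong re (trans (coefficient (Q.generating-stable m≤n) m ≤-refl) (coefficientQ m))

open import Data.Integer using (ℤ; +_; _-_)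

-- The identity holds for every r and L.
theorem1p8 : (r : ℕ) → 1 ≤ r → (l : ℕ) → (L : List ℕ) → SubsetEvenUpTo r (l ∷ L) → (n : ℕ)
    → (+ sumLengths (Pe r (l ∷ L) n) - + sumLengths (Po r (l ∷ L) n)) - + sumLengths (Q r (l ∷ L) n)
    ≡ + pairCount r (l ∷ L) n
theorem1p8 r _ l L _ n = trans (cong (_- + sumLengths (Q r (l ∷ L) n)) (Counting.ForResidues.length-identity r (l ∷ L) n))
                               (cancel (+ sumLengths (Q r (l ∷ L) n)) (+ pairCount r (l ∷ L) n))
  where
  open import Relation.Binary.PropositionalEquality using (trans; cong)
  open import Data.Integer using (_+_)
  open import Data.Integer.Tactic.RingSolver using (solve-∀)
  cancel : ∀ a b → (a + b) - a ≡ b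
  cancel = solve-∀
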